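{- Let $\Phi:\mathbf{H}^{\mathcal D}_{CK}\to\mathbf{Sh}^{\mathcal D}$ be the unique Hopf algebra morphism with $\pi\circ\Phi\circ i=\varphi$. For every nonempty tree $T$ of $\mathbf{H}^{\mathcal D}_{CK}$, $$\Phi(T)=\sum_{\boldsymbol e\subseteq E(T)}\ \sum_{\sigma\in\mathcal O(Cont_{\boldsymbol e}(T))}\varphi\big(\sigma^{ -1}(m_{\boldsymbol e})\big)\cdots\varphi\big(\sigma^{ -1}(1)\big),$$ where $m_{\boldsymbol e}$ is the number of vertices of $Cont_{\boldsymbol e}(T)$.
   Context: $\mathbb{K}$ is a field of characteristic zero, $\mathcal D$ a nonempty set. $\mathbf{H}^{\mathcal D}_{CK}$ is the Connes–Kreimer Hopf algebra of rooted forests with vertices decorated by $\mathcal D$ (product disjoint union, cut coproduct $\sum_{\boldsymbol v}Lea_{\boldsymbol v}(F)\otimes Roo_{\boldsymbol v}(F)$ over admissible cuts). $\mathbb{T}^{\mathcal D}_{\mathbf{H}_{CK}}$ is the set of nonempty decorated rooted trees, $i:\mathbb{K}(\mathbb{T}^{\mathcal D}_{\mathbf{H}_{CK}})\hookrightarrow\mathbf{H}^{\mathcal D}_{CK}$ the inclusion, $\varphi:\mathbb{K}(\mathbb{T}^{\mathcal D}_{\mathbf{H}_{CK}})\to\mathbb{K}(\mathcal D)$ a linear map. $\mathbf{Sh}^{\mathcal D}$ is the shuffle Hopf algebra on words over $\mathcal D$ (shuffle product, deconcatenation coproduct) and $\pi$ the projection onto words of length one, identified with $\mathbb{K}(\mathcal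 D)$; products of elements of $\mathbb{K}(\mathcal D)$ in the formula are concatenations, extended multilinearly. For $\boldsymbol e\subseteq E(T)$, $Part_{\boldsymbol e}(T)$ is the forest with all vertices of $T$ and the edges in $\boldsymbol e$ (decorations kept), and $Cont_{\boldsymbol e}(T)$ is the rooted tree obtained by contracting each edge of $\boldsymbol e$; each vertex of $Cont_{\boldsymbol e}(T)$ is identified with a connected component of $Part_{\boldsymbol e}(T)$, a decorated tree. For a rooted forest $G$, $\mathcal O(G)$ is the set of bijections $\sigma:V(G)\to\{1,\dots,|V(G)|\}$ such that $\sigma(a)\ge\sigma(b)$ whenever there is an oriented path from $a$ to $b$ towards the root; for $\sigma\in\mathcal O(Cont_{\boldsymbol e}(T))$, $\sigma^{ -1}(j)$ denotes the component of $Part_{\boldsymbol e}(T)$ corresponding to the vertex with image $j$. -}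

module Defs where

open import Level using (Level; _⊔_)
open import Data.Nat using (ℕ; zero; suc; _≤ᵇ_)
open import Data.Bool using (Bool; true; false; if_then_else_; _∧_; _∨_; not)
open import Data.Product using (_×_; _,_; Σ; ∃)
open import Data.Unit using (⊤; tt)
open import Data.List using (List; []; _∷_; _++_; map; concatMap; foldr; length; reverse; filter; allFin; lookup)
open import Data.Vec using (Vec; []; _∷_; toList)
open import Data.Fin using (Fin; toℕ)
open import Data.Empty using (⊥)
open import Relation.Nullary using (¬_)
open import Relation.Nullary.Decidable.Core using (T?)
open import Relation.Binary.PropositionalEquality using (_≡_)
open import Data.List.Membership.Propositional using (_∉_)
open import Algebra.Bundles using (CommutativeRing)

module _ {c ℓ} (R : CommutativeRing c ℓ) where
  open CommutativeRing R

  ofNat : ℕ → Carrier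
  ofNat zero    = 0#
  ofNat (suc n) = 1# + ofNat n

  IsFieldCR : Set (c ⊔ ℓ)
  IsFieldCR = (¬ (0# ≈ 1#)) × (∀ x → ¬ (x ≈ 0#) → Σ Carrier λ y → (x * y) ≈ 1#)

  CharZero : Set ℓ
  CharZero = ∀ n → ofNat (suc n) ≈ 0# → ⊥

-- Rooted trees (planar representatives; vertices decorated by A)

data Tree {a} (A : Set a) : Set a where
  node : A → List (Tree A) → Tree A

Forest : ∀ {a} → Set a → Set a
Forest A = List (Tree A)

module _ {a} {A : Set a} where

  -- Isomorphism of (non-planar) decorated rooted trees / forests:
  -- equality of the underlying unordered objects.
  data _≅T_ : Tree A → Tree A → Set a
  data _≅F_ : Forest A → Forest A → Set a

  data _≅T_ where
    node≅ : ∀ {x y ts us} → x ≡ y → ts ≅F us → node x ts ≅T node y us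

  -- forests are multisets of trees: permutation up to tree isomorphism
  data _≅F_ where
    []≅ : [] ≅F []
    ∷≅  : ∀ {t u ts xs ys} → t ≅T u → ts ≅F (xs ++ ys) → (t ∷ ts) ≅F (xs ++ u ∷ ys)

  -- Admissible cuts of a forest: one pair (Lea_v(F) , Roo_v(F)) per
  -- admissible cut v, i.e. per set of vertices closed under taking
  -- descendants (Lea = the cut-off upper part, Roo = the remaining part
  -- containing the roots). Includes the empty and the total cut.
  cutsT : Tree A → List (Forest A × Forest A)
  cutsF : Forest A → List (Forest A × Forest A)
  cutsT (node x ts) =
    (node x ts ∷ [] , []) ∷ map (λ { (l , r) → (l , node x r ∷ []) }) (cutsF ts)
  cutsF [] = ([] , []) ∷ []
  cutsF (t ∷ ts) =
    concatMap (λ { (l₁ , r₁) → map (λ { (l₂ , r₂) → (l₁ ++ l₂ , r₁ ++ r₂) }) (cutsF ts) }) (cutsT t)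

  -- Subsets of the edge set E(T): each non-root vertex carries a Bool saying
  -- whether the edge to its parent belongs to the subset.
  EdgeSubT : Tree A → Set
  EdgeSubF : Forest A → Set
  EdgeSubT (node x ts) = EdgeSubF ts
  EdgeSubF [] = ⊤
  EdgeSubF (t ∷ ts) = Bool × EdgeSubT t × EdgeSubF ts

  allEdgeSubT : (t : Tree A) → List (EdgeSubT t)
  allEdgeSubF : (ts : Forest A) → List (EdgeSubF ts)
  allEdgeSubT (node x ts) = allEdgeSubF ts
  allEdgeSubF [] = tt ∷ []
  allEdgeSubF (t ∷ ts) =
    concatMap (λ b → concatMap (λ e → map (λ es → (b , e , es)) (allEdgeSubF ts)) (allEdgeSubT t))
              (true ∷ false ∷ [])

  -- Cont_e(T), each vertex being decorated by the corresponding connected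
  -- component of Part_e(T) (a decorated tree).
  -- contF returns: the subtrees of the root component hanging from the
  -- given vertices' parent, and the children of the contracted vertex.
  contT : (t : Tree A) → EdgeSubT t → Tree (Tree A)
  contF : (ts : Forest A) → EdgeSubF ts → Forest A × Forest (Tree A)
  contT (node x ts) e with contF ts e
  ... | (cs , ks) = node (node x cs) ks
  contF [] tt = ([] , [])
  contF (t ∷ ts) (b , e , es) with contT t e | contF ts es
  ... | node c kids | (cs , ks) =
    if b then (c ∷ cs , kids ++ ks) else (cs , node c kids ∷ ks)

eqℕ : ℕ → ℕ → Bool
eqℕ zero zero = true
eqℕ (suc m) (suc n) = eqℕ m n
eqℕ _ _ = false

prefixᵇ : List ℕ → List ℕ → Bool
prefixᵇ [] _ = true
prefixᵇ (x ∷ xs) [] = false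
prefixᵇ (x ∷ xs) (y ∷ ys) = eqℕ x y ∧ prefixᵇ xs ys


-- Vertices of a rooted tree: listed in preorder, each with its decoration
-- and its address (list of child indices from the root).

module _ {a} {A : Set a} where

  vertsT : Tree A → List (A × List ℕ)
  vertsF : ℕ → Forest A → List (A × List ℕ)
  vertsT (node x ts) = (x , []) ∷ vertsF 0 ts
  vertsF i [] = []
  vertsF i (t ∷ ts) =
    map (λ { (y , p) → (y , i ∷ p) }) (vertsT t) ++ vertsF (suc i) ts

  nV : Tree A → ℕ
  nV t = length (vertsT t)

  vdec : (t : Tree A) → Fin (nV t) → A
  vdec t v = Data.Product.proj₁ (lookup (vertsT t) v)

  vaddr : (t : Tree A) → Fin (nV t) → List ℕ
  vaddr t v = Data.Product.proj₂ (lookup (vertsT t) v)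

  -- there is an oriented path from vertex u towards the root reaching b
  -- (b is u or an ancestor of u)
  pathᵇ : (t : Tree A) → Fin (nV t) → Fin (nV t) → Bool
  pathᵇ t u b = prefixᵇ (vaddr t b) (vaddr t u)

allVec : (m k : ℕ) → List (Vec (Fin k) m)
allVec zero k = [] ∷ []
allVec (suc m) k = concatMap (λ i → map (λ v → i ∷ v) (allVec m k)) (allFin k)

eqFin : ∀ {n} → Fin n → Fin n → Bool
eqFin i j = eqℕ (toℕ i) (toℕ j)

module _ {a} {A : Set a} where

  -- σ ∈ O(G) is represented through its inverse τ = σ⁻¹ :
  -- τ j = σ⁻¹ (j+1) for j : Fin m, m = |V(G)|.
  -- τ must be a bijection (injective, hence bijective on Fin m) and
  -- σ(u) ≥ σ(b) whenever there is a path from u to b towards the root.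
  IsOrdᵇ : (G : Tree A) → Vec (Fin (nV G)) (nV G) → Bool
  IsOrdᵇ G τ =
    foldr _∧_ true (concatMap (λ j → map (λ j' →
       (eqFin j j' ∨ not (eqFin (Data.Vec.lookup τ j) (Data.Vec.lookup τ j'))) ∧
       (not (pathᵇ G (Data.Vec.lookup τ j) (Data.Vec.lookup τ j')) ∨ (toℕ j' ≤ᵇ toℕ j)))
     (allFin (nV G))) (allFin (nV G)))

  linExt : (G : Tree A) → List (Vec (Fin (nV G)) (nV G))
  linExt G = filter (λ τ → T? (IsOrdᵇ G τ)) (allVec (nV G) (nV G))

-- An element of K(𝒟) is a coefficient function 𝒟 → K (finitely supported);
-- an element of Sh^𝒟 is a coefficient function on words List 𝒟 → K
-- (finitely supported). A linear map out of H_CK (resp. K(T)) is given by its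
-- values on the basis of forests (resp. trees).

module _ {c ℓ} (K : CommutativeRing c ℓ) where
  open CommutativeRing K

  sumK : List Carrier → Carrier
  sumK = foldr _+_ 0#

  unitCoeff : ∀ {b} {X : Set b} → List X → Carrier
  unitCoeff [] = 1#
  unitCoeff (_ ∷ _) = 0#

  module _ {d} {𝒟 : Set d} where

    FinSupp : ∀ {b} {X : Set b} → (X → Carrier) → Set (b ⊔ ℓ)
    FinSupp {X = X} f = Σ (List X) λ xs → ∀ x → x ∉ xs → f x ≈ 0#

    -- all ways of writing a word w as a shuffle of two words (u , v),
    -- counted with multiplicity: coefficient of w in u ⧢ v is the number
    -- of occurrences of (u , v) in this list.
    deshuffles : List 𝒟 → List (List 𝒟 × List 𝒟)
    deshuffles [] = ([] , []) ∷ []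
    deshuffles (x ∷ w) =
      concatMap (λ { (u , v) → (x ∷ u , v) ∷ (u , x ∷ v) ∷ [] }) (deshuffles w)

    -- concatenation product f₁ f₂ ⋯ f_m of elements of K(𝒟) (words of length
    -- one), as an element of Sh^𝒟, evaluated at a word.
    concatProd : List (𝒟 → Carrier) → List 𝒟 → Carrier
    concatProd [] [] = 1#
    concatProd [] (_ ∷ _) = 0#
    concatProd (f ∷ fs) [] = 0#
    concatProd (f ∷ fs) (x ∷ w) = f x * concatProd fs w

    -- φ : K(T^𝒟) → K(𝒟) linear, given on the basis of (isomorphism classes of)
    -- nonempty decorated rooted trees
    IsTreeMap : (Tree 𝒟 → 𝒟 → Carrier) → Set (ℓ ⊔ d)
    IsTreeMap φ =
      (∀ t u → t ≅T u → ∀ x → φ t x ≈ φ u x) ×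
      (∀ t → FinSupp (φ t))

    -- Φ : H_CK^𝒟 → Sh^𝒟 is a Hopf algebra morphism (i.e. a bialgebra morphism;
    -- compatibility with antipodes is then automatic) with π ∘ Φ ∘ i = φ.
    record IsHopfMorphismWith (φ : Tree 𝒟 → 𝒟 → Carrier)
                              (Φ : Forest 𝒟 → List 𝒟 → Carrier) : Set (ℓ ⊔ d) where
      field
        iso      : ∀ F G → F ≅F G → ∀ w → Φ F w ≈ Φ G w
        finSupp  : ∀ F → FinSupp (Φ F)
        unit     : ∀ w → Φ [] w ≈ unitCoeff w
        mult     : ∀ F G w → Φ (F ++ G) w ≈
                     sumK (map (λ { (u , v) → Φ F u * Φ G v }) (deshuffles w))
        -- coalgebra morphism: Δ_Sh ∘ Φ = (Φ ⊗ Φ) ∘ Δ_CK, read at u ⊗ v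
        comult   : ∀ F u v → Φ F (u ++ v) ≈
                     sumK (map (λ { (l , r) → Φ l u * Φ r v }) (cutsF F))
        counit   : ∀ F → Φ F [] ≈ unitCoeff F
        restrict : ∀ t x → Φ (t ∷ []) (x ∷ []) ≈ φ t x

    formulaRHS : (Tree 𝒟 → 𝒟 → Carrier) → Tree 𝒟 → List 𝒟 → Carrier
    formulaRHS φ T w =
      sumK (concatMap (λ e → let G = contT T e in
              map (λ τ → concatProd (reverse (toList (Data.Vec.map (λ v → φ (vdec G v)) τ))) w)
                  (linExt G))
             (allEdgeSubT T))

-- Read words backwards, so that the first letter belongs to the root.  For T with root x
-- and subtrees ts, compatibility of Φ with the coproduct splits Φ(T) at a word ending in y
-- along the admissible cuts of T; only cuts whose root part is a single tree t survive, with
-- factor φ(t)(y).  As Φ is multiplicative and Φ(F ++ F′) is a shuffle product, an induction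
-- over ts pairs each such cut with the edge subsets e whose root component is t.  On the
-- other side, the sum over σ ∈ O(Cont_e T) is the generating series of the root-first
-- orderings of the vertices of Cont_e T, which satisfies the same recursion: the root comes
-- first, and the orderings of a forest are the shuffles of those of its trees.
module Submission where

open import Defs
open import Level using (Level; _⊔_)
open import Function using (id; _∘_)
open import Function.Bundles using (mk⇔; Equivalence)
open import Data.Nat as ℕ using (ℕ; zero; suc; _≤_; _<_; z≤n; s≤s)
import Data.Nat.Properties as ℕₚ
open import Data.Bool using (Bool; true; false; if_then_else_; _∧_; _∨_; not)
import Data.Bool.Properties as Boolₚ
open import Data.Bool.ListAction using (and)
open import Data.Empty using (⊥; ⊥-elim)
open import Data.Fin using (Fin; toℕ; zero; suc)
import Data.Fin.Properties as Finₚ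
open import Data.Vec as Vec using (Vec; []; _∷_; toList)
open import Data.List using (List; []; _∷_; _++_; _∷ʳ_; map; concatMap; filter; reverse; length; allFin; lookup)
import Data.List.Properties as List
open import Data.List.Membership.Propositional using (_∈_)
open import Data.List.Membership.Propositional.Properties using (∈-allFin)
open import Data.List.Relation.Unary.Any using (here; there)
open import Data.List.Relation.Unary.All as All using (All; []; _∷_)
import Data.List.Relation.Unary.All.Properties as All
open import Data.Product using (_×_; _,_; proj₁; proj₂)
open import Relation.Nullary using (yes; no)
open import Relation.Nullary.Decidable.Core using (T?)
open import Relation.Binary.Definitions using (tri<; tri≈; tri>)
open import Relation.Binary.PropositionalEquality as ≡ using (_≡_; _≢_)
open import Algebra.Bundles using (CommutativeRing; CommutativeMonoid)
open import Algebra.Properties.CommutativeSemigroup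
  (CommutativeMonoid.commutativeSemigroup Boolₚ.∧-commutativeMonoid) using (xy∙z≈xz∙y)

module RingSums {c ℓ} (K : CommutativeRing c ℓ) where
  open CommutativeRing K
  open import Algebra.Properties.CommutativeSemigroup +-commutativeSemigroup public
    using () renaming (interchange to +-interchange)

  private variable
    a b : Level
    A : Set a
    B : Set b

  ∑ : List A → (A → Carrier) → Carrier
  ∑ xs f = sumK K (map f xs)

  infix 5 ∑
  syntax ∑ xs (λ x → e) = ∑[ x ∈ xs ] e

  ∑-cong : ∀ xs {f g : A → Carrier} → (∀ x → f x ≈ g x) → ∑ xs f ≈ ∑ xs g
  ∑-cong []       f≈g = refl
  ∑-cong (x ∷ xs) f≈g = +-cong (f≈g x) (∑-cong xs f≈g)

  ∑-congᴬ : ∀ {xs} {f g : A → Carrier} → All (λ x → f x ≈ g x) xs → ∑ xs f ≈ ∑ xs g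
  ∑-congᴬ []           = refl
  ∑-congᴬ (fx≈gx ∷ eqs) = +-cong fx≈gx (∑-congᴬ eqs)

  ∑-zeroᴬ : ∀ {xs} {f : A → Carrier} → All (λ x → f x ≈ 0#) xs → ∑ xs f ≈ 0#
  ∑-zeroᴬ []            = refl
  ∑-zeroᴬ (fx≈0 ∷ zeros) = trans (+-cong fx≈0 (∑-zeroᴬ zeros)) (+-identityˡ _)

  ∑-zero : ∀ xs {f : A → Carrier} → (∀ x → f x ≈ 0#) → ∑ xs f ≈ 0#
  ∑-zero []       f≈0 = refl
  ∑-zero (x ∷ xs) f≈0 = trans (+-cong (f≈0 x) (∑-zero xs f≈0)) (+-identityˡ _)

  ∑-++ : ∀ xs ys (f : A → Carrier) → ∑ (xs ++ ys) f ≈ ∑ xs f + ∑ ys f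
  ∑-++ []       ys f = sym (+-identityˡ _)
  ∑-++ (x ∷ xs) ys f = trans (+-congˡ (∑-++ xs ys f)) (sym (+-assoc _ _ _))

  ∑-+ : ∀ xs (f g : A → Carrier) → ∑[ x ∈ xs ] (f x + g x) ≈ ∑ xs f + ∑ xs g
  ∑-+ []       f g = sym (+-identityˡ _)
  ∑-+ (x ∷ xs) f g = trans (+-congˡ (∑-+ xs f g)) (+-interchange _ _ _ _)

  ∑-*ˡ : ∀ xs k (f : A → Carrier) → ∑[ x ∈ xs ] (k * f x) ≈ k * ∑ xs f
  ∑-*ˡ []       k f = sym (zeroʳ k)
  ∑-*ˡ (x ∷ xs) k f = trans (+-congˡ (∑-*ˡ xs k f)) (sym (distribˡ k _ _))

  ∑-*ʳ : ∀ xs k (f : A → Carrier) → ∑[ x ∈ xs ] (f x * k) ≈ ∑ xs f * k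
  ∑-*ʳ xs k f = trans (∑-cong xs (λ x → *-comm (f x) k)) (trans (∑-*ˡ xs k f) (*-comm k _))

  ∑-map : ∀ xs (g : A → B) (f : B → Carrier) → ∑ (map g xs) f ≈ ∑ xs (f ∘ g)
  ∑-map []       g f = refl
  ∑-map (x ∷ xs) g f = +-congˡ (∑-map xs g f)

  ∑-concatMap : ∀ xs (g : A → List B) (f : B → Carrier) →
                ∑ (concatMap g xs) f ≈ ∑[ x ∈ xs ] ∑ (g x) f
  ∑-concatMap []       g f = refl
  ∑-concatMap (x ∷ xs) g f = trans (∑-++ (g x) _ f) (+-congˡ (∑-concatMap xs g f))

  ∑-comm : ∀ xs (ys : List B) (f : A → B → Carrier) →
           ∑[ x ∈ xs ] ∑[ y ∈ ys ] f x y ≈ ∑[ y ∈ ys ] ∑[ x ∈ xs ] f x y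
  ∑-comm []       ys f = sym (∑-zero ys (λ _ → refl))
  ∑-comm (x ∷ xs) ys f = trans (+-congˡ (∑-comm xs ys f)) (sym (∑-+ ys (f x) _))

  guard : Bool → Carrier → Carrier
  guard b x = if b then x else 0#

  guard-cong : ∀ b {x y} → x ≈ y → guard b x ≈ guard b y
  guard-cong true  x≈y = x≈y
  guard-cong false x≈y = refl

  guard-zero : ∀ b → guard b 0# ≈ 0#
  guard-zero true  = refl
  guard-zero false = refl

  guard-*ˡ : ∀ b k x → guard b (k * x) ≈ k * guard b x
  guard-*ˡ true  k x = refl
  guard-*ˡ false k x = sym (zeroʳ k)

  ∑-filter : ∀ (p : A → Bool) xs (f : A → Carrier) →
             ∑ (filter (λ x → T? (p x)) xs) f ≈ ∑[ x ∈ xs ] guard (p x) (f x)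
  ∑-filter p []       f = refl
  ∑-filter p (x ∷ xs) f with p x
  ... | true  = +-congˡ (∑-filter p xs f)
  ... | false = trans (∑-filter p xs f) (sym (+-identityˡ _))

eqℕ-refl : ∀ n → eqℕ n n ≡ true
eqℕ-refl zero    = ≡.refl
eqℕ-refl (suc n) = eqℕ-refl n

eqℕ⇒≡ : ∀ m n → eqℕ m n ≡ true → m ≡ n
eqℕ⇒≡ zero    zero    _  = ≡.refl
eqℕ⇒≡ (suc m) (suc n) eq = ≡.cong suc (eqℕ⇒≡ m n eq)

≢⇒eqℕ-false : ∀ m n → m ≢ n → eqℕ m n ≡ false
≢⇒eqℕ-false m n m≢n with eqℕ m n in eq
... | true  = ⊥-elim (m≢n (eqℕ⇒≡ m n eq))
... | false = ≡.refl

module Words {c ℓ} (K : CommutativeRing c ℓ) {d} {𝒟 : Set d} where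
  open CommutativeRing K
  open RingSums K
  open import Relation.Binary.Reasoning.Setoid setoid

  Sh : Set (c ⊔ d)
  Sh = List 𝒟 → Carrier

  private
    concatProd-[]-∷ʳ : ∀ (u : List 𝒟) y → concatProd K [] (u ∷ʳ y) ≡ 0#
    concatProd-[]-∷ʳ []      y = ≡.refl
    concatProd-[]-∷ʳ (_ ∷ _) y = ≡.refl

    concatProd-∷ʳ-[] : ∀ (fs : List (𝒟 → Carrier)) g → concatProd K (fs ∷ʳ g) [] ≡ 0#
    concatProd-∷ʳ-[] []      g = ≡.refl
    concatProd-∷ʳ-[] (_ ∷ _) g = ≡.refl

  concatProd-∷ʳ : ∀ fs u g y → concatProd K (fs ∷ʳ g) (u ∷ʳ y) ≈ concatProd K fs u * g y
  concatProd-∷ʳ []       []      g y = trans (*-identityʳ _) (sym (*-identityˡ _))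
  concatProd-∷ʳ []       (z ∷ u) g y = begin
    g z * concatProd K [] (u ∷ʳ y) ≈⟨ *-congˡ (reflexive (concatProd-[]-∷ʳ u y)) ⟩
    g z * 0#                       ≈⟨ zeroʳ _ ⟩
    0#                             ≈⟨ sym (zeroˡ _) ⟩
    0# * g y                       ∎
  concatProd-∷ʳ (f ∷ fs) []      g y = begin
    f y * concatProd K (fs ∷ʳ g) [] ≈⟨ *-congˡ (reflexive (concatProd-∷ʳ-[] fs g)) ⟩
    f y * 0#                        ≈⟨ zeroʳ _ ⟩
    0#                              ≈⟨ sym (zeroˡ _) ⟩
    0# * g y                        ∎
  concatProd-∷ʳ (f ∷ fs) (z ∷ u) g y = trans (*-congˡ (concatProd-∷ʳ fs u g y)) (sym (*-assoc _ _ _))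

  concatProd-reverse : ∀ fs w → concatProd K fs w ≈ concatProd K (reverse fs) (reverse w)
  concatProd-reverse []       []      = refl
  concatProd-reverse []       (y ∷ w) rewrite List.unfold-reverse y w =
    reflexive (≡.sym (concatProd-[]-∷ʳ (reverse w) y))
  concatProd-reverse (g ∷ fs) []      rewrite List.unfold-reverse g fs =
    reflexive (≡.sym (concatProd-∷ʳ-[] (reverse fs) g))
  concatProd-reverse (g ∷ fs) (y ∷ w) rewrite List.unfold-reverse g fs | List.unfold-reverse y w = begin
    g y * concatProd K fs w                               ≈⟨ *-comm _ _ ⟩
    concatProd K fs w * g y                               ≈⟨ *-congʳ (concatProd-reverse fs w) ⟩
    concatProd K (reverse fs) (reverse w) * g y           ≈⟨ concatProd-∷ʳ (reverse fs) (reverse w) g y ⟨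
    concatProd K (reverse fs ∷ʳ g) (reverse w ∷ʳ y)       ∎

  concatProd-reverseˡ : ∀ fs w → concatProd K (reverse fs) w ≈ concatProd K fs (reverse w)
  concatProd-reverseˡ fs w = begin
    concatProd K (reverse fs) w                     ≡⟨ ≡.cong (concatProd K (reverse fs)) (List.reverse-involutive w) ⟨
    concatProd K (reverse fs) (reverse (reverse w)) ≈⟨ concatProd-reverse fs (reverse w) ⟨
    concatProd K fs (reverse w)                     ∎

  ∑⧢ : List 𝒟 → (List 𝒟 → List 𝒟 → Carrier) → Carrier
  ∑⧢ w F = ∑[ p ∈ deshuffles K w ] F (proj₁ p) (proj₂ p)

  infixl 7 _⧢_
  _⧢_ : Sh → Sh → Sh
  (A ⧢ B) w = ∑⧢ w (λ u v → A u * B v)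

  ∑⧢-∷ : ∀ x w F → ∑⧢ (x ∷ w) F ≈ ∑⧢ w (λ u v → F (x ∷ u) v + F u (x ∷ v))
  ∑⧢-∷ x w F = trans (∑-concatMap (deshuffles K w) _ _) (∑-cong (deshuffles K w) (λ _ → +-congˡ (+-identityʳ _)))

  ∑⧢-∷ʳ : ∀ w x F → ∑⧢ (w ∷ʳ x) F ≈ ∑⧢ w (λ u v → F (u ∷ʳ x) v + F u (v ∷ʳ x))
  ∑⧢-∷ʳ []      x F = ∑⧢-∷ x [] F
  ∑⧢-∷ʳ (z ∷ w) x F = begin
    ∑⧢ (z ∷ (w ∷ʳ x)) F
      ≈⟨ ∑⧢-∷ z (w ∷ʳ x) F ⟩
    ∑⧢ (w ∷ʳ x) (λ u v → F (z ∷ u) v + F u (z ∷ v))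
      ≈⟨ ∑⧢-∷ʳ w x _ ⟩
    ∑⧢ w (λ u v → (F (z ∷ u ∷ʳ x) v + F (u ∷ʳ x) (z ∷ v)) + (F (z ∷ u) (v ∷ʳ x) + F u (z ∷ v ∷ʳ x)))
      ≈⟨ ∑-cong (deshuffles K w) (λ _ → +-interchange _ _ _ _) ⟩
    ∑⧢ w (λ u v → (F (z ∷ u ∷ʳ x) v + F (z ∷ u) (v ∷ʳ x)) + (F (u ∷ʳ x) (z ∷ v) + F u (z ∷ v ∷ʳ x)))
      ≈⟨ ∑⧢-∷ z w _ ⟨
    ∑⧢ (z ∷ w) (λ u v → F (u ∷ʳ x) v + F u (v ∷ʳ x)) ∎

  ∑⧢-reverse : ∀ w F → ∑⧢ (reverse w) F ≈ ∑⧢ w (λ u v → F (reverse u) (reverse v))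
  ∑⧢-reverse []      F = refl
  ∑⧢-reverse (y ∷ w) F rewrite List.unfold-reverse y w = begin
    ∑⧢ (reverse w ∷ʳ y) F
      ≈⟨ ∑⧢-∷ʳ (reverse w) y F ⟩
    ∑⧢ (reverse w) (λ u v → F (u ∷ʳ y) v + F u (v ∷ʳ y))
      ≈⟨ ∑⧢-reverse w _ ⟩
    ∑⧢ w (λ u v → F (reverse u ∷ʳ y) (reverse v) + F (reverse u) (reverse v ∷ʳ y))
      ≈⟨ ∑-cong (deshuffles K w) (λ (u , v) → reflexive (≡.cong₂ (λ u′ v′ → F u′ (reverse v) + F (reverse u) v′)
                                    (≡.sym (List.unfold-reverse y u)) (≡.sym (List.unfold-reverse y v)))) ⟩
    ∑⧢ w (λ u v → F (reverse (y ∷ u)) (reverse v) + F (reverse u) (reverse (y ∷ v)))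
      ≈⟨ ∑⧢-∷ y w _ ⟨
    ∑⧢ (y ∷ w) (λ u v → F (reverse u) (reverse v)) ∎

  ∑⧢-cong : ∀ w {F G : List 𝒟 → List 𝒟 → Carrier} →
            (∀ u v → length u ℕ.+ length v ≡ length w → F u v ≈ G u v) → ∑⧢ w F ≈ ∑⧢ w G
  ∑⧢-cong []      F≈G = +-congʳ (F≈G [] [] ≡.refl)
  ∑⧢-cong (x ∷ w) {F} {G} F≈G = trans (∑⧢-∷ x w F) (trans (∑⧢-cong w F∷≈G∷) (sym (∑⧢-∷ x w G)))
    where
    F∷≈G∷ : ∀ u v → length u ℕ.+ length v ≡ length w → F (x ∷ u) v + F u (x ∷ v) ≈ G (x ∷ u) v + G u (x ∷ v)
    F∷≈G∷ u v |u|+|v|≡|w| =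
      +-cong (F≈G (x ∷ u) v (≡.cong suc |u|+|v|≡|w|))
             (F≈G u (x ∷ v) (≡.trans (ℕₚ.+-suc (length u) (length v)) (≡.cong suc |u|+|v|≡|w|)))

  ⧢-cong : ∀ {A A′ B B′ : Sh} → (∀ u → A u ≈ A′ u) → (∀ v → B v ≈ B′ v) →
           ∀ w → (A ⧢ B) w ≈ (A′ ⧢ B′) w
  ⧢-cong A≈A′ B≈B′ w = ∑-cong (deshuffles K w) (λ _ → *-cong (A≈A′ _) (B≈B′ _))

  ∑-⧢ˡ : ∀ {i} {I : Set i} (xs : List I) (A : I → Sh) (B : Sh) w →
         ∑[ x ∈ xs ] (A x ⧢ B) w ≈ ((λ u → ∑[ x ∈ xs ] A x u) ⧢ B) w
  ∑-⧢ˡ xs A B w = trans (∑-comm xs (deshuffles K w) _) (∑-cong (deshuffles K w) (λ _ → ∑-*ʳ xs _ _))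

  ∑-⧢ʳ : ∀ {i} {I : Set i} (xs : List I) (A : Sh) (B : I → Sh) (k : I → Carrier) w →
         ∑[ x ∈ xs ] ((A ⧢ B x) w * k x) ≈ (A ⧢ (λ v → ∑[ x ∈ xs ] (B x v * k x))) w
  ∑-⧢ʳ xs A B k w = begin
    ∑[ x ∈ xs ] ((A ⧢ B x) w * k x)
      ≈⟨ ∑-cong xs (λ x → ∑-*ʳ (deshuffles K w) (k x) _) ⟨
    ∑[ x ∈ xs ] ∑[ p ∈ deshuffles K w ] ((A (proj₁ p) * B x (proj₂ p)) * k x)
      ≈⟨ ∑-comm xs (deshuffles K w) _ ⟩
    ∑[ p ∈ deshuffles K w ] ∑[ x ∈ xs ] ((A (proj₁ p) * B x (proj₂ p)) * k x)
      ≈⟨ ∑-cong (deshuffles K w) (λ _ → trans (∑-cong xs (λ _ → *-assoc _ _ _)) (∑-*ˡ xs _ _)) ⟩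
    (A ⧢ (λ v → ∑[ x ∈ xs ] (B x v * k x))) w ∎

  guard-⧢ˡ : ∀ b k (A B : Sh) w → ∑⧢ w (λ u v → guard b (k * A u) * B v) ≈ guard b (k * (A ⧢ B) w)
  guard-⧢ˡ true  k A B w = trans (∑-cong (deshuffles K w) (λ _ → *-assoc _ _ _)) (∑-*ˡ (deshuffles K w) k _)
  guard-⧢ˡ false k A B w = ∑-zero (deshuffles K w) (λ _ → zeroˡ _)

  guard-⧢ʳ : ∀ b k (A B : Sh) w → ∑⧢ w (λ u v → A u * guard b (k * B v)) ≈ guard b (k * (A ⧢ B) w)
  guard-⧢ʳ true  k A B w = trans (∑-cong (deshuffles K w) (λ _ → trans (sym (*-assoc _ _ _))
                             (trans (*-congʳ (*-comm _ _)) (*-assoc _ _ _)))) (∑-*ˡ (deshuffles K w) k _)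
  guard-⧢ʳ false k A B w = ∑-zero (deshuffles K w) (λ _ → zeroʳ _)

  Deg : ℕ → Sh → Sh
  Deg n A w = guard (eqℕ (length w) n) (A w)

  Deg-cong : ∀ n {A A′ : Sh} → (∀ u → A u ≈ A′ u) → ∀ w → Deg n A w ≈ Deg n A′ w
  Deg-cong n A≈A′ w = guard-cong (eqℕ (length w) n) (A≈A′ w)

  Deg-≡ : ∀ n A w → length w ≡ n → Deg n A w ≈ A w
  Deg-≡ n A w ≡.refl rewrite eqℕ-refl (length w) = refl

  Deg-≢ : ∀ n A w → length w ≢ n → Deg n A w ≈ 0#
  Deg-≢ n A w |w|≢n rewrite ≢⇒eqℕ-false _ _ |w|≢n = refl

  VanishesAbove : ℕ → Sh → Set (ℓ ⊔ d)
  VanishesAbove n A = ∀ u → n ℕ.< length u → A u ≈ 0#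

  private
    +-≡-<⇒> : ∀ a b c d → a ℕ.+ b ≡ c ℕ.+ d → a ℕ.< c → d ℕ.< b
    +-≡-<⇒> a b c d eq a<c with b ℕ.≤? d
    ... | yes b≤d = ⊥-elim (ℕₚ.<⇒≢ (ℕₚ.+-mono-<-≤ a<c b≤d) eq)
    ... | no  b≰d = ℕₚ.≰⇒> b≰d

  Deg-⧢ : ∀ m n {A B} → VanishesAbove m A → VanishesAbove n B →
          ∀ w → Deg (m ℕ.+ n) (A ⧢ B) w ≈ (Deg m A ⧢ Deg n B) w
  Deg-⧢ m n {A} {B} A↑ B↑ w with length w ℕ.≟ m ℕ.+ n
  ... | yes |w|≡m+n = trans (Deg-≡ (m ℕ.+ n) (A ⧢ B) w |w|≡m+n) (∑⧢-cong w split)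
    where
    split : ∀ u v → length u ℕ.+ length v ≡ length w → A u * B v ≈ Deg m A u * Deg n B v
    split u v eq with ℕₚ.<-cmp (length u) m
    ... | tri< |u|<m _ _ = begin
      A u * B v            ≈⟨ *-congˡ (B↑ v (+-≡-<⇒> _ _ _ _ (≡.trans eq |w|≡m+n) |u|<m)) ⟩
      A u * 0#             ≈⟨ zeroʳ _ ⟩
      0#                   ≈⟨ zeroˡ _ ⟨
      0# * Deg n B v       ≈⟨ *-congʳ (Deg-≢ m A u (ℕₚ.<⇒≢ |u|<m)) ⟨
      Deg m A u * Deg n B v ∎
    ... | tri> _ _ |u|>m = begin
      A u * B v            ≈⟨ *-congʳ (A↑ u |u|>m) ⟩
      0# * B v             ≈⟨ zeroˡ _ ⟩
      0#                   ≈⟨ zeroˡ _ ⟨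
      0# * Deg n B v       ≈⟨ *-congʳ (Deg-≢ m A u (ℕₚ.>⇒≢ |u|>m)) ⟨
      Deg m A u * Deg n B v ∎
    ... | tri≈ _ |u|≡m _ = sym (*-cong (Deg-≡ m A u |u|≡m) (Deg-≡ n B v |v|≡n))
      where
      |v|≡n : length v ≡ n
      |v|≡n = ℕₚ.+-cancelˡ-≡ m _ _ (≡.trans (≡.cong (ℕ._+ length v) (≡.sym |u|≡m)) (≡.trans eq |w|≡m+n))
  ... | no |w|≢m+n = trans (Deg-≢ (m ℕ.+ n) (A ⧢ B) w |w|≢m+n)
                            (sym (trans (∑⧢-cong w vanish) (∑-zero (deshuffles K w) (λ _ → refl))))
    where
    vanish : ∀ u v → length u ℕ.+ length v ≡ length w → Deg m A u * Deg n B v ≈ 0#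
    vanish u v eq with length u ℕ.≟ m
    ... | no  |u|≢m = trans (*-congʳ (Deg-≢ m A u |u|≢m)) (zeroˡ _)
    ... | yes |u|≡m = trans (*-congˡ (Deg-≢ n B v |v|≢n)) (zeroʳ _)
      where
      |v|≢n : length v ≢ n
      |v|≢n |v|≡n = |w|≢m+n (≡.trans (≡.sym eq) (≡.cong₂ ℕ._+_ |u|≡m |v|≡n))

  unitCoeff-reverse : ∀ (w : List 𝒟) → unitCoeff K (reverse w) ≡ unitCoeff K w
  unitCoeff-reverse []      = ≡.refl
  unitCoeff-reverse (y ∷ w) rewrite List.unfold-reverse y w = unitCoeff-∷ʳ (reverse w)
    where
    unitCoeff-∷ʳ : ∀ (u : List 𝒟) → unitCoeff K (u ∷ʳ y) ≡ 0#
    unitCoeff-∷ʳ []      = ≡.refl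
    unitCoeff-∷ʳ (_ ∷ _) = ≡.refl

-- orderings L allowed w is the weighted count of the sequences p₁ … pₖ of elements of L,
-- k = |w|, such that every pⱼ is allowed and canFollow pᵢ pⱼ for i < j; the sequence
-- has weight ∏ᵢ weight pᵢ wᵢ.
module Orderings {c ℓ} (K : CommutativeRing c ℓ) {d} {𝒟 : Set d} {e} {E : Set e}
                 (weight : E → 𝒟 → CommutativeRing.Carrier K) (canFollow : E → E → Bool) where
  open CommutativeRing K
  open RingSums K
  open Words K {𝒟 = 𝒟}
  open import Relation.Binary.Reasoning.Setoid setoid

  orderings : List E → (E → Bool) → Sh
  orderings L allowed []      = 1#
  orderings L allowed (y ∷ w) =
    ∑[ p ∈ L ] guard (allowed p) (weight p y * orderings L (λ q → allowed q ∧ canFollow p q) w)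

  orderings-cong : ∀ L {o o′ : E → Bool} → All (λ q → o q ≡ o′ q) L → ∀ w → orderings L o w ≈ orderings L o′ w
  orderings-cong L o≡o′ []      = refl
  orderings-cong L {o} {o′} o≡o′ (y ∷ w) = ∑-congᴬ (All.map (λ {p} → step p) o≡o′)
    where
    step : ∀ p → o p ≡ o′ p →
           guard (o p) (weight p y * orderings L (λ q → o q ∧ canFollow p q) w) ≈
           guard (o′ p) (weight p y * orderings L (λ q → o′ q ∧ canFollow p q) w)
    step p op≡o′p rewrite op≡o′p = guard-cong (o′ p) (*-congˡ
      (orderings-cong L (All.map (λ {q} oq≡o′q → ≡.cong (_∧ canFollow p q) oq≡o′q) o≡o′) w))

  orderings-drop : ∀ q L (o : E → Bool) → o q ≡ false → ∀ w → orderings (q ∷ L) o w ≈ orderings L o w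
  orderings-drop q L o oq≡false []      = refl
  orderings-drop q L o oq≡false (y ∷ w) rewrite oq≡false =
    trans (+-identityˡ _) (∑-cong L (λ p → guard-cong (o p) (*-congˡ
      (orderings-drop q L _ (≡.cong (_∧ canFollow p q) oq≡false) w))))

  countAllowed : (E → Bool) → List E → ℕ
  countAllowed o []      = 0
  countAllowed o (q ∷ L) = if o q then suc (countAllowed o L) else countAllowed o L

  countAllowed-∧ : ∀ L (o b : E → Bool) → countAllowed (λ q → o q ∧ b q) L ≤ countAllowed o L
  countAllowed-∧ []      o b = z≤n
  countAllowed-∧ (q ∷ L) o b with o q | b q
  ... | true  | true  = s≤s (countAllowed-∧ L o b)
  ... | true  | false = ℕₚ.m≤n⇒m≤1+n (countAllowed-∧ L o b)
  ... | false | _     = countAllowed-∧ L o b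

  countAllowed-after : ∀ L (o : E → Bool) {p} → p ∈ L → o p ≡ true → canFollow p p ≡ false →
                       countAllowed (λ q → o q ∧ canFollow p q) L < countAllowed o L
  countAllowed-after (q ∷ L) o {p} (here ≡.refl) op p↛p rewrite op | p↛p = s≤s (countAllowed-∧ L o (canFollow p))
  countAllowed-after (q ∷ L) o {p} (there p∈L) op p↛p with o q | canFollow p q
  ... | true  | true  = s≤s (countAllowed-after L o p∈L op p↛p)
  ... | true  | false = ℕₚ.m≤n⇒m≤1+n (countAllowed-after L o p∈L op p↛p)
  ... | false | _     = countAllowed-after L o p∈L op p↛p

  Irreflexive : List E → Set e
  Irreflexive = All (λ p → canFollow p p ≡ false)

  orderings-long : ∀ L (o : E → Bool) w → Irreflexive L → countAllowed o L < length w → orderings L o w ≈ 0#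
  orderings-long L o (y ∷ w) irr count<|yw| = ∑-zeroᴬ (All.tabulate (λ {p} → step p))
    where
    step : ∀ p → p ∈ L → guard (o p) (weight p y * orderings L (λ q → o q ∧ canFollow p q) w) ≈ 0#
    step p p∈L with o p in op
    ... | false = refl
    ... | true  = trans (*-congˡ (orderings-long L _ w irr
      (ℕₚ.≤-trans (countAllowed-after L o p∈L op (All.lookup irr p∈L)) (ℕₚ.≤-pred count<|yw|)))) (zeroʳ _)

  AllFollow : List E → List E → Set e
  AllFollow L₁ L₂ = All (λ p → All (λ q → canFollow p q ≡ true) L₂) L₁

  AllAllowed : (E → Bool) → List E → Set e
  AllAllowed o = All (λ q → o q ≡ true)

  -- Two mutually unconstrained lists interleave freely, hence the shuffle product.
  orderings-++ : ∀ L₁ L₂ (o₁ o₂ : E → Bool) → AllAllowed o₂ L₁ → AllAllowed o₁ L₂ →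
                 AllFollow L₁ L₂ → AllFollow L₂ L₁ →
                 ∀ w → orderings (L₁ ++ L₂) (λ q → o₁ q ∧ o₂ q) w ≈ (orderings L₁ o₁ ⧢ orderings L₂ o₂) w
  orderings-++ L₁ L₂ o₁ o₂ o₂L₁ o₁L₂ L₁→L₂ L₂→L₁ []      = sym (trans (+-identityʳ _) (*-identityʳ _))
  orderings-++ L₁ L₂ o₁ o₂ o₂L₁ o₁L₂ L₁→L₂ L₂→L₁ (y ∷ w) = begin
    ∑ (L₁ ++ L₂) first                           ≈⟨ ∑-++ L₁ L₂ first ⟩
    ∑ L₁ first + ∑ L₂ first                      ≈⟨ +-cong firstFrom₁ firstFrom₂ ⟩
    ∑⧢ w (λ u v → A (y ∷ u) * B v) + ∑⧢ w (λ u v → A u * B (y ∷ v))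
      ≈⟨ ∑-+ (deshuffles K w) _ _ ⟨
    ∑⧢ w (λ u v → A (y ∷ u) * B v + A u * B (y ∷ v))
      ≈⟨ ∑⧢-∷ y w (λ u v → A u * B v) ⟨
    (A ⧢ B) (y ∷ w)                              ∎
    where
    A B : Sh
    A = orderings L₁ o₁
    B = orderings L₂ o₂
    first : E → Carrier
    first p = guard (o₁ p ∧ o₂ p) (weight p y * orderings (L₁ ++ L₂) (λ q → (o₁ q ∧ o₂ q) ∧ canFollow p q) w)

    ∧-cong : ∀ {o o′ b b′ : E → Bool} {L} → All (λ q → o q ≡ o′ q) L → All (λ q → b q ≡ b′ q) L →
             All (λ q → (o q ∧ b q) ≡ (o′ q ∧ b′ q)) L
    ∧-cong eqs eqs′ = All.zipWith (λ (eq , eq′) → ≡.cong₂ _∧_ eq eq′) (eqs , eqs′)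

    firstFrom₁-step : ∀ p → o₂ p ≡ true → All (λ q → canFollow p q ≡ true) L₂ →
                      first p ≈ guard (o₁ p) (weight p y * (orderings L₁ (λ q → o₁ q ∧ canFollow p q) ⧢ B) w)
    firstFrom₁-step p o₂p p→L₂ rewrite o₂p | Boolₚ.∧-identityʳ (o₁ p) = guard-cong (o₁ p) (*-congˡ
      (trans (orderings-cong (L₁ ++ L₂) (All.universal (λ q → xy∙z≈xz∙y (o₁ q) (o₂ q) (canFollow p q)) _) w)
             (orderings-++ L₁ L₂ _ o₂ o₂L₁ (∧-cong o₁L₂ p→L₂) L₁→L₂ L₂→L₁ w)))

    firstFrom₂-step : ∀ p → o₁ p ≡ true → All (λ q → canFollow p q ≡ true) L₁ →
                      first p ≈ guard (o₂ p) (weight p y * (A ⧢ orderings L₂ (λ q → o₂ q ∧ canFollow p q)) w)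
    firstFrom₂-step p o₁p p→L₁ rewrite o₁p = guard-cong (o₂ p) (*-congˡ
      (trans (orderings-cong (L₁ ++ L₂) (All.universal (λ q → Boolₚ.∧-assoc (o₁ q) (o₂ q) (canFollow p q)) _) w)
             (orderings-++ L₁ L₂ o₁ _ (∧-cong o₂L₁ p→L₁) o₁L₂ L₁→L₂ L₂→L₁ w)))

    firstFrom₁ : ∑ L₁ first ≈ ∑⧢ w (λ u v → A (y ∷ u) * B v)
    firstFrom₁ = begin
      ∑ L₁ first
        ≈⟨ ∑-congᴬ (All.zipWith (λ (o₂p , p→L₂) → firstFrom₁-step _ o₂p p→L₂) (o₂L₁ , L₁→L₂)) ⟩
      ∑[ p ∈ L₁ ] guard (o₁ p) (weight p y * (orderings L₁ (λ q → o₁ q ∧ canFollow p q) ⧢ B) w)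
        ≈⟨ ∑-cong L₁ (λ p → guard-⧢ˡ (o₁ p) (weight p y) _ B w) ⟨
      ∑[ p ∈ L₁ ] ∑⧢ w (λ u v → guard (o₁ p) (weight p y * orderings L₁ (λ q → o₁ q ∧ canFollow p q) u) * B v)
        ≈⟨ ∑-comm L₁ (deshuffles K w) _ ⟩
      ∑⧢ w (λ u v → ∑[ p ∈ L₁ ] (guard (o₁ p) (weight p y * orderings L₁ (λ q → o₁ q ∧ canFollow p q) u) * B v))
        ≈⟨ ∑-cong (deshuffles K w) (λ _ → ∑-*ʳ L₁ _ _) ⟩
      ∑⧢ w (λ u v → A (y ∷ u) * B v) ∎

    firstFrom₂ : ∑ L₂ first ≈ ∑⧢ w (λ u v → A u * B (y ∷ v))
    firstFrom₂ = begin
      ∑ L₂ first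
        ≈⟨ ∑-congᴬ (All.zipWith (λ (o₁p , p→L₁) → firstFrom₂-step _ o₁p p→L₁) (o₁L₂ , L₂→L₁)) ⟩
      ∑[ p ∈ L₂ ] guard (o₂ p) (weight p y * (A ⧢ orderings L₂ (λ q → o₂ q ∧ canFollow p q)) w)
        ≈⟨ ∑-cong L₂ (λ p → guard-⧢ʳ (o₂ p) (weight p y) A _ w) ⟨
      ∑[ p ∈ L₂ ] ∑⧢ w (λ u v → A u * guard (o₂ p) (weight p y * orderings L₂ (λ q → o₂ q ∧ canFollow p q) v))
        ≈⟨ ∑-comm L₂ (deshuffles K w) _ ⟩
      ∑⧢ w (λ u v → ∑[ p ∈ L₂ ] (A u * guard (o₂ p) (weight p y * orderings L₂ (λ q → o₂ q ∧ canFollow p q) v)))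
        ≈⟨ ∑-cong (deshuffles K w) (λ _ → ∑-*ˡ L₂ _ _) ⟩
      ∑⧢ w (λ u v → A u * B (y ∷ v)) ∎

module OrderingsMap {c ℓ} (K : CommutativeRing c ℓ) {d} {𝒟 : Set d} {e e′} {E : Set e} {E′ : Set e′}
                    (weight : E → 𝒟 → CommutativeRing.Carrier K) (canFollow : E → E → Bool)
                    (weight′ : E′ → 𝒟 → CommutativeRing.Carrier K) (canFollow′ : E′ → E′ → Bool)
                    (g : E → E′) where
  open CommutativeRing K
  open RingSums K
  private
    module O  = Orderings K weight canFollow
    module O′ = Orderings K weight′ canFollow′

  orderings-map : ∀ L (o : E → Bool) (o′ : E′ → Bool) → All (λ q → o′ (g q) ≡ o q) L →
                  All (λ q → ∀ y → weight′ (g q) y ≈ weight q y) L →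
                  All (λ p → All (λ q → canFollow′ (g p) (g q) ≡ canFollow p q) L) L →
                  ∀ w → O′.orderings (map g L) o′ w ≈ O.orderings L o w
  orderings-map L o o′ o′∘g≡o weights follows []      = refl
  orderings-map L o o′ o′∘g≡o weights follows (y ∷ w) =
    trans (∑-map L g _) (∑-congᴬ (All.zipWith (λ (eq , (wt , fl)) → step _ eq wt fl)
                                              (o′∘g≡o , All.zip (weights , follows))))
    where
    step : ∀ p → o′ (g p) ≡ o p → (∀ y → weight′ (g p) y ≈ weight p y) →
           All (λ q → canFollow′ (g p) (g q) ≡ canFollow p q) L →
           guard (o′ (g p)) (weight′ (g p) y * O′.orderings (map g L) (λ q → o′ q ∧ canFollow′ (g p) q) w) ≈
           guard (o p) (weight p y * O.orderings L (λ q → o q ∧ canFollow p q) w)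
    step p eq wt fl rewrite eq = guard-cong (o p) (*-cong (wt y)
      (orderings-map L _ _ (All.zipWith (λ (x , z) → ≡.cong₂ _∧_ x z) (o′∘g≡o , fl)) weights follows w))

prefixᵇ-refl : ∀ a → prefixᵇ a a ≡ true
prefixᵇ-refl []      = ≡.refl
prefixᵇ-refl (k ∷ a) rewrite eqℕ-refl k = prefixᵇ-refl a

private
  ∧-true : ∀ {a b} → a ≡ true → b ≡ true → a ∧ b ≡ true
  ∧-true ≡.refl ≡.refl = ≡.refl

  not-true⇒false : ∀ {a} → not a ≡ true → a ≡ false
  not-true⇒false {false} _ = ≡.refl

  false⇒not-true : ∀ {a} → a ≡ false → not a ≡ true
  false⇒not-true ≡.refl = ≡.refl

  ∨-trueˡ : ∀ {a} b → a ≡ true → a ∨ b ≡ true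
  ∨-trueˡ b ≡.refl = ≡.refl

  ∨-trueʳ : ∀ a {b} → b ≡ true → a ∨ b ≡ true
  ∨-trueʳ a ≡.refl = Boolₚ.∨-zeroʳ a

  ∨-true-falseʳ : ∀ {a b} → a ∨ b ≡ true → b ≡ false → a ≡ true
  ∨-true-falseʳ {a} a∨b b≡false rewrite b≡false | Boolₚ.∨-identityʳ a = a∨b

  ∧-trueˡ : ∀ {a b} → a ∧ b ≡ true → a ≡ true
  ∧-trueˡ = Boolₚ.∧-conicalˡ _ _

  ∧-trueʳ : ∀ {a b} → a ∧ b ≡ true → b ≡ true
  ∧-trueʳ = Boolₚ.∧-conicalʳ _ _

  and-++ : ∀ bs cs → and (bs ++ cs) ≡ and bs ∧ and cs
  and-++ []       cs = ≡.refl
  and-++ (b ∷ bs) cs = ≡.trans (≡.cong (b ∧_) (and-++ bs cs)) (≡.sym (Boolₚ.∧-assoc b _ _))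

  and-map⁻ : ∀ {a} {A : Set a} (f : A → Bool) xs → and (map f xs) ≡ true → ∀ {x} → x ∈ xs → f x ≡ true
  and-map⁻ f (x ∷ xs) all-f (here ≡.refl) = ∧-trueˡ all-f
  and-map⁻ f (x ∷ xs) all-f (there x∈xs)  = and-map⁻ f xs (∧-trueʳ {f x} all-f) x∈xs

  and-map⁺ : ∀ {a} {A : Set a} (f : A → Bool) xs → (∀ x → f x ≡ true) → and (map f xs) ≡ true
  and-map⁺ f []       f-true = ≡.refl
  and-map⁺ f (x ∷ xs) f-true = ∧-true (f-true x) (and-map⁺ f xs f-true)

  and-concatMap⁻ : ∀ {a} {A : Set a} (f : A → List Bool) xs → and (concatMap f xs) ≡ true →
                   ∀ {x} → x ∈ xs → and (f x) ≡ true
  and-concatMap⁻ f (x ∷ xs) all-f (here ≡.refl) = ∧-trueˡ (≡.trans (≡.sym (and-++ (f x) _)) all-f)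
  and-concatMap⁻ f (x ∷ xs) all-f (there x∈xs)  =
    and-concatMap⁻ f xs (∧-trueʳ {and (f x)} (≡.trans (≡.sym (and-++ (f x) _)) all-f)) x∈xs

  and-concatMap⁺ : ∀ {a} {A : Set a} (f : A → List Bool) xs → (∀ x → and (f x) ≡ true) → and (concatMap f xs) ≡ true
  and-concatMap⁺ f []       f-true = ≡.refl
  and-concatMap⁺ f (x ∷ xs) f-true = ≡.trans (and-++ (f x) _) (∧-true (f-true x) (and-concatMap⁺ f xs f-true))

-- σ ∈ O(G) listed through σ⁻¹ (root first) are exactly the orderings of all vertices of G
-- in which no vertex is followed by one of its ancestors.
module LinearExtensions {c ℓ} (K : CommutativeRing c ℓ) {d} {𝒟 : Set d} {b} {B : Set b}
                        (G : Tree B) (f : B → 𝒟 → CommutativeRing.Carrier K) where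
  open CommutativeRing K hiding (zero)
  open RingSums K
  open Words K {𝒟 = 𝒟}
  open import Relation.Binary.Reasoning.Setoid setoid

  private
    n : ℕ
    n = nV G
    path : Fin n → Fin n → Bool
    path = pathᵇ G

  weight : Fin n → 𝒟 → Carrier
  weight v = f (vdec G v)

  canFollow : Fin n → Fin n → Bool
  canFollow i j = not (path i j)

  open Orderings K weight canFollow public using (orderings)

  admissibleᵇ : ∀ {m} → (Fin n → Bool) → Vec (Fin n) m → Bool
  admissibleᵇ o []      = true
  admissibleᵇ o (i ∷ v) = o i ∧ admissibleᵇ (λ j → o j ∧ canFollow i j) v

  RespectsPaths : ∀ {m} → Vec (Fin n) m → Set
  RespectsPaths {m} v = ∀ (j j′ : Fin m) → toℕ j < toℕ j′ → path (Vec.lookup v j) (Vec.lookup v j′) ≡ false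

  admissibleᵇ-sound : ∀ {m} o (v : Vec (Fin n) m) → admissibleᵇ o v ≡ true →
                      (∀ j → o (Vec.lookup v j) ≡ true) × RespectsPaths v
  admissibleᵇ-sound o []      _  = (λ ()) , (λ ())
  admissibleᵇ-sound o (i ∷ v) ok = allowed , respects
    where
    rest : (∀ j → o (Vec.lookup v j) ∧ canFollow i (Vec.lookup v j) ≡ true) × RespectsPaths v
    rest = admissibleᵇ-sound (λ j → o j ∧ canFollow i j) v (∧-trueʳ {o i} ok)
    allowed : ∀ j → o (Vec.lookup (i ∷ v) j) ≡ true
    allowed zero    = ∧-trueˡ ok
    allowed (suc j) = ∧-trueˡ (proj₁ rest j)
    respects : RespectsPaths (i ∷ v)
    respects zero    (suc j′) _         = not-true⇒false (∧-trueʳ {o (Vec.lookup v j′)} (proj₁ rest j′))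
    respects (suc j) (suc j′) (s≤s j<j′) = proj₂ rest j j′ j<j′

  admissibleᵇ-complete : ∀ {m} o (v : Vec (Fin n) m) → (∀ j → o (Vec.lookup v j) ≡ true) → RespectsPaths v →
                         admissibleᵇ o v ≡ true
  admissibleᵇ-complete o []      allowed respects = ≡.refl
  admissibleᵇ-complete o (i ∷ v) allowed respects = ∧-true (allowed zero) (admissibleᵇ-complete _ v
    (λ j → ∧-true (allowed (suc j)) (false⇒not-true (respects zero (suc j) (s≤s z≤n))))
    (λ j j′ j<j′ → respects (suc j) (suc j′) (s≤s j<j′)))

  private
    ≤ᵇ-false : ∀ a b → b < a → (a ℕ.≤ᵇ b) ≡ false
    ≤ᵇ-false a b b<a with a ℕ.≤ᵇ b in eq
    ... | true  = ⊥-elim (ℕₚ.<⇒≱ b<a (ℕₚ.≤ᵇ⇒≤ a b (Equivalence.from Boolₚ.T-≡ eq)))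
    ... | false = ≡.refl

    ≤⇒≤ᵇ-true : ∀ {a b} → a ℕ.≤ b → (a ℕ.≤ᵇ b) ≡ true
    ≤⇒≤ᵇ-true a≤b = Equivalence.to Boolₚ.T-≡ (ℕₚ.≤⇒≤ᵇ a≤b)

    pathᵇ-refl : ∀ u → path u u ≡ true
    pathᵇ-refl u = prefixᵇ-refl (vaddr G u)

    eqFin-false : ∀ (i j : Fin n) → i ≢ j → eqFin i j ≡ false
    eqFin-false i j i≢j = ≢⇒eqℕ-false (toℕ i) (toℕ j) (λ eq → i≢j (Finₚ.toℕ-injective eq))

  -- IsOrdᵇ checks injectivity and the path condition pair by pair; the path condition alone
  -- already forces injectivity since path is reflexive.
  IsOrdᵇ≡admissibleᵇ : ∀ τ → IsOrdᵇ G τ ≡ admissibleᵇ (λ _ → true) τ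
  IsOrdᵇ≡admissibleᵇ τ = Boolₚ.⇔→≡ (mk⇔ sound complete)
    where
    τ[_] : Fin n → Fin n
    τ[_] = Vec.lookup τ
    pairCheck : Fin n → Fin n → Bool
    pairCheck j j′ = (eqFin j j′ ∨ not (eqFin τ[ j ] τ[ j′ ])) ∧ (not (path τ[ j ] τ[ j′ ]) ∨ (toℕ j′ ℕ.≤ᵇ toℕ j))

    sound : IsOrdᵇ G τ ≡ true → admissibleᵇ (λ _ → true) τ ≡ true
    sound ord = admissibleᵇ-complete _ τ (λ _ → ≡.refl) respects
      where
      respects : RespectsPaths τ
      respects j j′ j<j′ = not-true⇒false (∨-true-falseʳ
        (∧-trueʳ {eqFin j j′ ∨ not (eqFin τ[ j ] τ[ j′ ])}
          (and-map⁻ _ _ (and-concatMap⁻ _ _ ord (∈-allFin j)) (∈-allFin j′)))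
        (≤ᵇ-false (toℕ j′) (toℕ j) j<j′))

    complete : admissibleᵇ (λ _ → true) τ ≡ true → IsOrdᵇ G τ ≡ true
    complete adm = and-concatMap⁺ _ (allFin n) (λ j → and-map⁺ (pairCheck j) (allFin n) (check j))
      where
      respects : RespectsPaths τ
      respects = proj₂ (admissibleᵇ-sound _ τ adm)
      distinct : ∀ j j′ → toℕ j < toℕ j′ → τ[ j ] ≢ τ[ j′ ]
      distinct j j′ j<j′ eq
        with ≡.trans (≡.sym (respects j j′ j<j′)) (≡.subst (λ v → path τ[ j ] v ≡ true) eq (pathᵇ-refl τ[ j ]))
      ... | ()
      check : ∀ j j′ → pairCheck j j′ ≡ true
      check j j′ with ℕₚ.<-cmp (toℕ j) (toℕ j′)
      ... | tri< j<j′ _ _ = ∧-true (∨-trueʳ (eqFin j j′) (false⇒not-true (eqFin-false _ _ (distinct j j′ j<j′))))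
                                   (∨-trueˡ _ (false⇒not-true (respects j j′ j<j′)))
      ... | tri> _ _ j>j′ = ∧-true (∨-trueʳ (eqFin j j′) (false⇒not-true (eqFin-false _ _ (distinct j′ j j>j′ ∘ ≡.sym))))
                                   (∨-trueʳ (not (path τ[ j ] τ[ j′ ])) (≤⇒≤ᵇ-true (ℕₚ.<⇒≤ j>j′)))
      ... | tri≈ _ j≡j′ _ with Finₚ.toℕ-injective {i = j} {j = j′} j≡j′
      ...   | ≡.refl = ∧-true (∨-trueˡ _ (eqℕ-refl (toℕ j))) (∨-trueʳ _ (≤⇒≤ᵇ-true (ℕₚ.≤-refl {toℕ j})))

  ∑-admissible : ∀ m o w →
    ∑[ τ ∈ allVec m n ] guard (admissibleᵇ o τ) (concatProd K (toList (Vec.map weight τ)) w) ≈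
    Deg m (orderings (allFin n) o) w
  ∑-admissible ℕ.zero    o []      = +-identityʳ _
  ∑-admissible ℕ.zero    o (y ∷ w) = +-identityʳ _
  ∑-admissible (ℕ.suc m) o []      = ∑-zero (allVec (ℕ.suc m) n) (λ { (i ∷ v) → guard-zero (admissibleᵇ o (i ∷ v)) })
  ∑-admissible (ℕ.suc m) o (y ∷ w) = begin
    ∑ (concatMap (λ i → map (i ∷_) (allVec m n)) (allFin n)) term
      ≈⟨ ∑-concatMap (allFin n) _ term ⟩
    ∑[ i ∈ allFin n ] ∑ (map (i ∷_) (allVec m n)) term
      ≈⟨ ∑-cong (allFin n) (λ i → trans (∑-map (allVec m n) (i ∷_) term) (startingWith i)) ⟩
    ∑[ i ∈ allFin n ] guard (o i) (weight i y * Deg m (orderings (allFin n) (after i)) w)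
      ≈⟨ guard-outside (eqℕ (length w) m) ⟩
    Deg (ℕ.suc m) (orderings (allFin n) o) (y ∷ w) ∎
    where
    after : Fin n → Fin n → Bool
    after i j = o j ∧ canFollow i j
    term : Vec (Fin n) (ℕ.suc m) → Carrier
    term τ = guard (admissibleᵇ o τ) (concatProd K (toList (Vec.map weight τ)) (y ∷ w))
    startingWith : ∀ i → ∑[ v ∈ allVec m n ] term (i ∷ v) ≈
                         guard (o i) (weight i y * Deg m (orderings (allFin n) (after i)) w)
    startingWith i with o i
    ... | false = ∑-zero (allVec m n) (λ _ → refl)
    ... | true  = trans (∑-cong (allVec m n) (λ v → guard-*ˡ (admissibleᵇ (after i) v) (weight i y) _))
                        (trans (∑-*ˡ (allVec m n) (weight i y) _) (*-congˡ (∑-admissible m (after i) w)))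
    guard-outside : ∀ b → ∑[ i ∈ allFin n ] guard (o i) (weight i y * guard b (orderings (allFin n) (after i) w)) ≈
                          guard b (∑[ i ∈ allFin n ] guard (o i) (weight i y * orderings (allFin n) (after i) w))
    guard-outside true  = refl
    guard-outside false = ∑-zero (allFin n) (λ i → trans (guard-cong (o i) (zeroʳ _)) (guard-zero (o i)))

shiftHead : ℕ → List ℕ → List ℕ
shiftHead j []      = []
shiftHead j (k ∷ a) = (j ℕ.+ k) ∷ a

eqℕ-+ˡ : ∀ j k k′ → eqℕ (j ℕ.+ k) (j ℕ.+ k′) ≡ eqℕ k k′
eqℕ-+ˡ zero    k k′ = ≡.refl
eqℕ-+ˡ (suc j) k k′ = eqℕ-+ˡ j k k′

prefixᵇ-shiftHead : ∀ j a b → prefixᵇ (shiftHead j a) (shiftHead j b) ≡ prefixᵇ a b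
prefixᵇ-shiftHead j []      b        = ≡.refl
prefixᵇ-shiftHead j (k ∷ a) []       = ≡.refl
prefixᵇ-shiftHead j (k ∷ a) (k′ ∷ b) = ≡.cong (_∧ prefixᵇ a b) (eqℕ-+ˡ j k k′)

HeadIn : ℕ → ℕ → List ℕ → Set
HeadIn lo hi []      = ⊥
HeadIn lo hi (k ∷ _) = lo ≤ k × k < hi

HeadIn-disjoint : ∀ {lo₁ hi₁ lo₂ hi₂} a b → HeadIn lo₁ hi₁ a → HeadIn lo₂ hi₂ b → hi₁ ≤ lo₂ →
                  prefixᵇ b a ≡ false × prefixᵇ a b ≡ false
HeadIn-disjoint (k ∷ a) (k′ ∷ b) (_ , k<hi₁) (lo₂≤k′ , _) hi₁≤lo₂ =
  ≡.cong (_∧ prefixᵇ b a) (≢⇒eqℕ-false k′ k (λ eq → ℕₚ.<-irrefl (≡.sym eq) k<k′)) ,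
  ≡.cong (_∧ prefixᵇ a b) (≢⇒eqℕ-false k k′ (λ eq → ℕₚ.<-irrefl eq k<k′))
  where
  k<k′ : k < k′
  k<k′ = ℕₚ.<-≤-trans k<hi₁ (ℕₚ.≤-trans hi₁≤lo₂ lo₂≤k′)

module Vertices {b} {B : Set b} where

  readdress : (List ℕ → List ℕ) → B × List ℕ → B × List ℕ
  readdress h (x , a) = (x , h a)

  vertsF-++ : ∀ i (F F′ : Forest B) → vertsF i (F ++ F′) ≡ vertsF i F ++ vertsF (i ℕ.+ length F) F′
  vertsF-++ i []      F′ = ≡.cong (λ k → vertsF k F′) (≡.sym (ℕₚ.+-identityʳ i))
  vertsF-++ i (t ∷ F) F′ = ≡.trans (≡.cong (map _ (vertsT t) ++_)
    (≡.trans (vertsF-++ (suc i) F F′) (≡.cong (λ k → vertsF (suc i) F ++ vertsF k F′) (≡.sym (ℕₚ.+-suc i (length F))))))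
    (≡.sym (List.++-assoc (map _ (vertsT t)) _ _))

  vertsF-+ : ∀ j i (F : Forest B) → vertsF (j ℕ.+ i) F ≡ map (readdress (shiftHead j)) (vertsF i F)
  vertsF-+ j i []      = ≡.refl
  vertsF-+ j i (t ∷ F) = ≡.trans
    (≡.cong₂ _++_ (≡.trans (List.map-cong (λ _ → ≡.refl) (vertsT t)) (List.map-∘ (vertsT t)))
                  (≡.trans (≡.cong (λ k → vertsF k F) (≡.sym (ℕₚ.+-suc j i))) (vertsF-+ j (suc i) F)))
    (≡.sym (List.map-++ (readdress (shiftHead j)) (map _ (vertsT t)) (vertsF (suc i) F)))

  vertsF-shift : ∀ j (F : Forest B) → vertsF j F ≡ map (readdress (shiftHead j)) (vertsF 0 F)
  vertsF-shift j F = ≡.trans (≡.cong (λ k → vertsF k F) (≡.sym (ℕₚ.+-identityʳ j))) (vertsF-+ j 0 F)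

  length-vertsF : ∀ j (F : Forest B) → length (vertsF j F) ≡ length (vertsF 0 F)
  length-vertsF j F = ≡.trans (≡.cong length (vertsF-shift j F)) (List.length-map (readdress (shiftHead j)) (vertsF 0 F))

  vertsF-HeadIn : ∀ i (F : Forest B) → All (λ p → HeadIn i (i ℕ.+ length F) (proj₂ p)) (vertsF i F)
  vertsF-HeadIn i []      = []
  vertsF-HeadIn i (t ∷ F) = All.++⁺ (All.map⁺ (All.universal (λ _ → ℕₚ.≤-refl , i<i+1+|F|) (vertsT t)))
                                    (All.map (λ {p} → widen (proj₂ p)) (vertsF-HeadIn (suc i) F))
    where
    i<i+1+|F| : i < i ℕ.+ suc (length F)
    i<i+1+|F| = ≡.subst (i <_) (≡.sym (ℕₚ.+-suc i (length F))) (s≤s (ℕₚ.m≤m+n i (length F)))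
    widen : ∀ a → HeadIn (suc i) (suc i ℕ.+ length F) a → HeadIn i (i ℕ.+ suc (length F)) a
    widen (k ∷ a) (1+i≤k , k<) = ℕₚ.≤-trans (ℕₚ.n≤1+n i) 1+i≤k , ≡.subst (k <_) (≡.sym (ℕₚ.+-suc i (length F))) k<

-- rootFirstT G w sums, over the orderings of the vertices of G in which every vertex precedes
-- its descendants, the product of f (decoration of the i-th vertex) (i-th letter of w).
module RootFirst {c ℓ} (K : CommutativeRing c ℓ) {d} {𝒟 : Set d} {b} {B : Set b}
                 (f : B → 𝒟 → CommutativeRing.Carrier K) where
  open CommutativeRing K
  open RingSums K
  open Words K {𝒟 = 𝒟}
  open Vertices {B = B}
  open import Relation.Binary.Reasoning.Setoid setoid

  Vertex : Set b
  Vertex = B × List ℕ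

  weight : Vertex → 𝒟 → Carrier
  weight (x , _) = f x

  -- q may come after p unless q is p or an ancestor of p
  canFollow : Vertex → Vertex → Bool
  canFollow (_ , a) (_ , a′) = not (prefixᵇ a′ a)

  open Orderings K weight canFollow

  everything : Vertex → Bool
  everything _ = true

  rootFirstT : Tree B → Sh
  rootFirstT G = Deg (nV G) (orderings (vertsT G) everything)

  rootFirstF : Forest B → Sh
  rootFirstF F = Deg (length (vertsF 0 F)) (orderings (vertsF 0 F) everything)

  linExtSum : Tree B → Sh
  linExtSum G w = ∑[ τ ∈ linExt G ] concatProd K (reverse (toList (Vec.map (λ v → f (vdec G v)) τ))) w

  linExtSum≈rootFirstT : ∀ G w → linExtSum G w ≈ rootFirstT G (reverse w)
  linExtSum≈rootFirstT G w = begin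
    linExtSum G w
      ≈⟨ ∑-cong (linExt G) (λ τ → concatProd-reverseˡ (toList (Vec.map LE.weight τ)) w) ⟩
    ∑[ τ ∈ linExt G ] concatProd K (toList (Vec.map LE.weight τ)) (reverse w)
      ≈⟨ ∑-filter (IsOrdᵇ G) (allVec n n) _ ⟩
    ∑[ τ ∈ allVec n n ] guard (IsOrdᵇ G τ) (concatProd K (toList (Vec.map LE.weight τ)) (reverse w))
      ≈⟨ ∑-cong (allVec n n) (λ τ → reflexive (≡.cong (λ ok → guard ok (concatProd K (toList (Vec.map LE.weight τ)) (reverse w)))
                                                        (LE.IsOrdᵇ≡admissibleᵇ τ))) ⟩
    ∑[ τ ∈ allVec n n ] guard (LE.admissibleᵇ everyVertex τ) (concatProd K (toList (Vec.map LE.weight τ)) (reverse w))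
      ≈⟨ LE.∑-admissible n everyVertex (reverse w) ⟩
    Deg n (LE.orderings (allFin n) everyVertex) (reverse w)
      ≈⟨ Deg-cong n (λ u → sym (trans (reflexive (≡.cong (λ L → orderings L everything u) (≡.sym vertsT≡)))
           (ToVertices.orderings-map (allFin n) everyVertex everything
             (All.universal (λ _ → ≡.refl) _) (All.universal (λ _ _ → refl) _)
             (All.universal (λ _ → All.universal (λ _ → ≡.refl) _) _) u))) (reverse w) ⟩
    rootFirstT G (reverse w) ∎
    where
    n : ℕ
    n = nV G
    module LE = LinearExtensions K G f
    module ToVertices = OrderingsMap K LE.weight LE.canFollow weight canFollow (lookup (vertsT G))
    everyVertex : Fin n → Bool
    everyVertex _ = true
    vertsT≡ : map (lookup (vertsT G)) (allFin n) ≡ vertsT G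
    vertsT≡ = ≡.trans (List.map-tabulate id (lookup (vertsT G))) (List.tabulate-lookup (vertsT G))

  canFollow-irreflexive : ∀ L → Irreflexive L
  canFollow-irreflexive L = All.universal (λ p → ≡.cong not (prefixᵇ-refl (proj₂ p))) L

  countAllowed-everything : ∀ L → countAllowed everything L ≡ length L
  countAllowed-everything []      = ≡.refl
  countAllowed-everything (_ ∷ L) = ≡.cong suc (countAllowed-everything L)

  orderings-everything-long : ∀ L → VanishesAbove (length L) (orderings L everything)
  orderings-everything-long L u |L|<|u| = orderings-long L everything u (canFollow-irreflexive L)
    (≡.subst (_< length u) (≡.sym (countAllowed-everything L)) |L|<|u|)

  private
    readdress-orderings : ∀ h L → (∀ a a′ → prefixᵇ (h a) (h a′) ≡ prefixᵇ a a′) →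
                          ∀ u → orderings (map (readdress h) L) everything u ≈ orderings L everything u
    readdress-orderings h L h-preserves = orderings-map L everything everything
      (All.universal (λ _ → ≡.refl) L) (All.universal (λ _ _ → refl) L)
      (All.universal (λ p → All.universal (λ q → ≡.cong not (h-preserves (proj₂ q) (proj₂ p))) L) L)
      where open OrderingsMap K weight canFollow weight canFollow (readdress h)

  orderings-vertsF : ∀ j (F : Forest B) u → orderings (vertsF j F) everything u ≈ orderings (vertsF 0 F) everything u
  orderings-vertsF j F u = trans (reflexive (≡.cong (λ L → orderings L everything u) (vertsF-shift j F)))
    (readdress-orderings (shiftHead j) (vertsF 0 F) (prefixᵇ-shiftHead j) u)

  rootFirstF-[] : ∀ w → rootFirstF [] w ≈ unitCoeff K w
  rootFirstF-[] []      = refl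
  rootFirstF-[] (_ ∷ _) = refl

  rootFirstF-[_] : ∀ (t : Tree B) w → rootFirstF (t ∷ []) w ≈ rootFirstT t w
  rootFirstF-[ t ] w = begin
    rootFirstF (t ∷ []) w
      ≡⟨ ≡.cong₂ (λ L n → Deg n (orderings L everything) w) verts≡
                 (≡.trans (≡.cong length verts≡) (List.length-map (readdress (0 ∷_)) (vertsT t))) ⟩
    Deg (nV t) (orderings (map (readdress (0 ∷_)) (vertsT t)) everything) w
      ≈⟨ Deg-cong (nV t) (readdress-orderings (0 ∷_) (vertsT t) (λ _ _ → ≡.refl)) w ⟩
    rootFirstT t w ∎
    where
    verts≡ : vertsF 0 (t ∷ []) ≡ map (readdress (0 ∷_)) (vertsT t)
    verts≡ = ≡.trans (List.++-identityʳ _) (List.map-cong (λ _ → ≡.refl) (vertsT t))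

  rootFirstT-[] : ∀ (G : Tree B) → rootFirstT G [] ≈ 0#
  rootFirstT-[] (node r ks) = refl

  -- The vertices of F and of F′ sit below different children of the root, so neither
  -- constrains the other.
  rootFirstF-++ : ∀ (F F′ : Forest B) w → rootFirstF (F ++ F′) w ≈ (rootFirstF F ⧢ rootFirstF F′) w
  rootFirstF-++ F F′ w = begin
    rootFirstF (F ++ F′) w
      ≡⟨ ≡.cong₂ (λ L n → Deg n (orderings L everything) w) verts≡
           (≡.trans (≡.cong length verts≡) (≡.trans (List.length-++ V) (≡.cong (length V ℕ.+_) (length-vertsF (length F) F′)))) ⟩
    Deg (length V ℕ.+ length V′) (orderings (V ++ V″) everything) w
      ≈⟨ Deg-cong _ (orderings-++ V V″ everything everything (All.universal (λ _ → ≡.refl) V) (All.universal (λ _ → ≡.refl) V″)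
                       V→V″ V″→V) w ⟩
    Deg (length V ℕ.+ length V′) (orderings V everything ⧢ orderings V″ everything) w
      ≈⟨ Deg-cong _ (⧢-cong (λ _ → refl) (orderings-vertsF (length F) F′)) w ⟩
    Deg (length V ℕ.+ length V′) (orderings V everything ⧢ orderings V′ everything) w
      ≈⟨ Deg-⧢ (length V) (length V′) (orderings-everything-long V) (orderings-everything-long V′) w ⟩
    (rootFirstF F ⧢ rootFirstF F′) w ∎
    where
    V V′ V″ : List Vertex
    V  = vertsF 0 F
    V′ = vertsF 0 F′
    V″ = vertsF (length F) F′
    verts≡ : vertsF 0 (F ++ F′) ≡ V ++ V″
    verts≡ = vertsF-++ 0 F F′
    separated : ∀ {p q} → HeadIn 0 (length F) (proj₂ p) → HeadIn (length F) (length F ℕ.+ length F′) (proj₂ q) →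
                canFollow p q ≡ true × canFollow q p ≡ true
    separated {p} {q} hp hq with HeadIn-disjoint (proj₂ p) (proj₂ q) hp hq ℕₚ.≤-refl
    ... | q⊀p , p⊀q = ≡.cong not q⊀p , ≡.cong not p⊀q
    V→V″ : AllFollow V V″
    V→V″ = All.map (λ {p} hp → All.map (λ {q} hq → proj₁ (separated {p} {q} hp hq)) (vertsF-HeadIn (length F) F′))
                   (vertsF-HeadIn 0 F)
    V″→V : AllFollow V″ V
    V″→V = All.map (λ {q} hq → All.map (λ {p} hp → proj₂ (separated {p} {q} hp hq)) (vertsF-HeadIn 0 F))
                   (vertsF-HeadIn (length F) F′)

  -- In a root-first ordering of a tree of n vertices, the root must come first: any other
  -- first vertex forbids its ancestors, leaving fewer than n - 1 allowed vertices.
  rootFirstT-node : ∀ r (ks : Forest B) y w → rootFirstT (node r ks) (y ∷ w) ≈ f r y * rootFirstF ks w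
  rootFirstT-node r ks y w with eqℕ (length w) (length (vertsF 0 ks)) in |w|≟
  ... | false = sym (zeroʳ _)
  ... | true  = begin
    f r y * orderings (root ∷ V) (canFollow root) w + (∑[ p ∈ V ] (weight p y * orderings (root ∷ V) (canFollow p) w))
      ≈⟨ +-cong (*-congˡ (trans (orderings-drop root V _ ≡.refl w)
                                (orderings-cong V (All.map (λ {q} → rootAbove {q}) (vertsF-HeadIn 0 ks)) w)))
                (∑-zeroᴬ (All.tabulate (λ {p} p∈V → trans (*-congˡ (nonRootFirst p∈V)) (zeroʳ (weight p y))))) ⟩
    f r y * orderings V everything w + 0#
      ≈⟨ +-identityʳ _ ⟩
    f r y * orderings V everything w ∎
    where
    V : List Vertex
    V = vertsF 0 ks
    root : Vertex
    root = (r , [])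
    rootAbove : ∀ {q} → HeadIn 0 (0 ℕ.+ length ks) (proj₂ q) → canFollow root q ≡ everything q
    rootAbove {_ , _ ∷ _} _ = ≡.refl
    nonRootFirst : ∀ {p} → p ∈ V → orderings (root ∷ V) (canFollow p) w ≈ 0#
    nonRootFirst {p} p∈V = trans (orderings-drop root V _ ≡.refl w) (orderings-long V (canFollow p) w (canFollow-irreflexive V)
      (≡.subst (_ ℕ.≤_) (≡.trans (countAllowed-everything V) (≡.sym (eqℕ⇒≡ _ _ |w|≟)))
        (countAllowed-after V everything p∈V ≡.refl (All.lookup (canFollow-irreflexive V) p∈V))))

module Expansion {c ℓ} (K : CommutativeRing c ℓ) {d} {𝒟 : Set d}
                 (φ : Tree 𝒟 → 𝒟 → CommutativeRing.Carrier K) (Φ : Forest 𝒟 → List 𝒟 → CommutativeRing.Carrier K)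
                 (Φ-hopf : IsHopfMorphismWith K φ Φ) where
  open CommutativeRing K
  open RingSums K
  open Words K {𝒟 = 𝒟}
  open RootFirst K φ
  open IsHopfMorphismWith Φ-hopf
  open import Relation.Binary.Reasoning.Setoid setoid

  Φʳ : Forest 𝒟 → Sh
  Φʳ F w = Φ F (reverse w)

  Φʳ-++ : ∀ F G w → Φʳ (F ++ G) w ≈ (Φʳ F ⧢ Φʳ G) w
  Φʳ-++ F G w = trans (mult F G (reverse w)) (∑⧢-reverse w (λ u v → Φ F u * Φ G v))

  Φʳ-[] : ∀ w → Φʳ [] w ≈ unitCoeff K w
  Φʳ-[] w = trans (unit (reverse w)) (reflexive (unitCoeff-reverse w))

  -- contF ts e = (joined ts e , split ts e): the trees of ts whose root edge is in e, cut down
  -- to the component of their root, and the remaining vertices of Cont_e as a forest.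
  joined : (ts : Forest 𝒟) → EdgeSubF ts → Forest 𝒟
  joined ts e = proj₁ (contF ts e)

  split : (ts : Forest 𝒟) → EdgeSubF ts → Forest (Tree 𝒟)
  split ts e = proj₂ (contF ts e)

  TreeExpansion : Tree 𝒟 → Set (ℓ ⊔ d)
  TreeExpansion T = ∀ w → Φʳ (T ∷ []) w ≈ ∑[ e ∈ allEdgeSubT T ] rootFirstT (contT T e) w

  -- Each admissible cut (leaves , roots) of ts matches the edge subsets e of ts for which
  -- roots is the forest of root components and leaves the rest of Cont_e.
  CutExpansion : Forest 𝒟 → Set (c ⊔ ℓ ⊔ d)
  CutExpansion ts = ∀ (g : Forest 𝒟 → Carrier) w →
    ∑[ p ∈ cutsF ts ] (Φʳ (proj₁ p) w * g (proj₂ p)) ≈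
    ∑[ e ∈ allEdgeSubF ts ] (rootFirstF (split ts e) w * g (joined ts e))

  treeExpansion-node : ∀ x ts → CutExpansion ts → TreeExpansion (node x ts)
  treeExpansion-node x ts cuts [] = trans (counit (node x ts ∷ []))
    (sym (∑-zero (allEdgeSubT (node x ts)) (λ e → rootFirstT-[] (contT (node x ts) e))))
  treeExpansion-node x ts cuts (y ∷ w) = begin
    Φ (T ∷ []) (reverse (y ∷ w))
      ≡⟨ ≡.cong (Φ (T ∷ [])) (List.unfold-reverse y w) ⟩
    Φ (T ∷ []) (reverse w ++ y ∷ [])
      ≈⟨ comult (T ∷ []) (reverse w) (y ∷ []) ⟩
    ∑[ p ∈ cutsF (T ∷ []) ] (Φ (proj₁ p) (reverse w) * Φ (proj₂ p) (y ∷ []))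
      ≈⟨ ∑-concatMap (cutsT T) (λ p → (proj₁ p ++ [] , proj₂ p ++ []) ∷ [])
                                 (λ p → Φ (proj₁ p) (reverse w) * Φ (proj₂ p) (y ∷ [])) ⟩
    ∑[ p ∈ cutsT T ] (Φʳ (proj₁ p ++ []) w * Φ (proj₂ p ++ []) (y ∷ []) + 0#)
      ≈⟨ ∑-cong (cutsT T) (λ p → trans (+-identityʳ _) (reflexive (≡.cong₂ (λ l r → Φʳ l w * Φ r (y ∷ []))
                                   (List.++-identityʳ (proj₁ p)) (List.++-identityʳ (proj₂ p))))) ⟩
    Φʳ (T ∷ []) w * Φ [] (y ∷ []) + ∑ (map _ (cutsF ts)) (λ p → Φʳ (proj₁ p) w * Φ (proj₂ p) (y ∷ []))
      ≈⟨ +-cong (trans (*-congˡ (unit (y ∷ []))) (zeroʳ _)) (∑-map (cutsF ts) _ _) ⟩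
    0# + (∑[ p ∈ cutsF ts ] (Φʳ (proj₁ p) w * Φ (node x (proj₂ p) ∷ []) (y ∷ [])))
      ≈⟨ trans (+-identityˡ _) (∑-cong (cutsF ts) (λ p → *-congˡ (restrict (node x (proj₂ p)) y))) ⟩
    ∑[ p ∈ cutsF ts ] (Φʳ (proj₁ p) w * φ (node x (proj₂ p)) y)
      ≈⟨ cuts (λ r → φ (node x r) y) w ⟩
    ∑[ e ∈ allEdgeSubF ts ] (rootFirstF (split ts e) w * φ (node x (joined ts e)) y)
      ≈⟨ ∑-cong (allEdgeSubF ts) (λ e → trans (*-comm _ _)
           (sym (rootFirstT-node (node x (joined ts e)) (split ts e) y w))) ⟩
    ∑[ e ∈ allEdgeSubT T ] rootFirstT (contT T e) (y ∷ w) ∎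
    where
    T : Tree 𝒟
    T = node x ts

  cutExpansion-[] : CutExpansion []
  cutExpansion-[] g w = +-congʳ (*-congʳ (trans (Φʳ-[] w) (sym (rootFirstF-[] w))))

  module _ (a : 𝒟) (us ts : Forest 𝒟) (g : Forest 𝒟 → Carrier) (w : List 𝒟) where
    private
      t : Tree 𝒟
      t = node a us

    cutWholeTree : TreeExpansion t → CutExpansion ts →
      ∑[ p ∈ cutsF ts ] (Φʳ (t ∷ proj₁ p) w * g (proj₂ p)) ≈
      ∑[ e ∈ allEdgeSubF us ] ∑[ es ∈ allEdgeSubF ts ] (rootFirstF (contT t e ∷ split ts es) w * g (joined ts es))
    cutWholeTree tree cuts = begin
      ∑[ p ∈ cutsF ts ] (Φʳ (t ∷ proj₁ p) w * g (proj₂ p))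
        ≈⟨ ∑-cong (cutsF ts) (λ p → *-congʳ (Φʳ-++ (t ∷ []) (proj₁ p) w)) ⟩
      ∑[ p ∈ cutsF ts ] ((Φʳ (t ∷ []) ⧢ Φʳ (proj₁ p)) w * g (proj₂ p))
        ≈⟨ ∑-⧢ʳ (cutsF ts) _ _ _ w ⟩
      (Φʳ (t ∷ []) ⧢ (λ v → ∑[ p ∈ cutsF ts ] (Φʳ (proj₁ p) v * g (proj₂ p)))) w
        ≈⟨ ⧢-cong tree (cuts g) w ⟩
      ((λ u → ∑[ e ∈ allEdgeSubF us ] rootFirstT (contT t e) u) ⧢ rest) w
        ≈⟨ ∑-⧢ˡ (allEdgeSubF us) _ _ w ⟨
      ∑[ e ∈ allEdgeSubF us ] (rootFirstT (contT t e) ⧢ rest) w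
        ≈⟨ ∑-cong (allEdgeSubF us) (λ e → begin
             (rootFirstT (contT t e) ⧢ rest) w
               ≈⟨ ∑-⧢ʳ (allEdgeSubF ts) _ _ _ w ⟨
             ∑[ es ∈ allEdgeSubF ts ] ((rootFirstT (contT t e) ⧢ rootFirstF (split ts es)) w * g (joined ts es))
               ≈⟨ ∑-cong (allEdgeSubF ts) (λ es → *-congʳ (trans
                    (⧢-cong (λ u → sym (rootFirstF-[ contT t e ] u)) (λ _ → refl) w)
                    (sym (rootFirstF-++ (contT t e ∷ []) (split ts es) w)))) ⟩
             ∑[ es ∈ allEdgeSubF ts ] (rootFirstF (contT t e ∷ split ts es) w * g (joined ts es)) ∎) ⟩
      ∑[ e ∈ allEdgeSubF us ] ∑[ es ∈ allEdgeSubF ts ] (rootFirstF (contT t e ∷ split ts es) w * g (joined ts es)) ∎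
      where
      rest : Sh
      rest v = ∑[ es ∈ allEdgeSubF ts ] (rootFirstF (split ts es) v * g (joined ts es))

    cutBelowRoot : CutExpansion us → CutExpansion ts →
      ∑[ p ∈ cutsF us ] ∑[ p′ ∈ cutsF ts ] (Φʳ (proj₁ p ++ proj₁ p′) w * g (node a (proj₂ p) ∷ proj₂ p′)) ≈
      ∑[ e ∈ allEdgeSubF us ] ∑[ es ∈ allEdgeSubF ts ]
        (rootFirstF (split us e ++ split ts es) w * g (node a (joined us e) ∷ joined ts es))
    cutBelowRoot cutsᵘ cutsᵗ = begin
      ∑[ p ∈ cutsF us ] ∑[ p′ ∈ cutsF ts ] (Φʳ (proj₁ p ++ proj₁ p′) w * g (node a (proj₂ p) ∷ proj₂ p′))
        ≈⟨ ∑-cong (cutsF us) (λ p → begin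
             ∑[ p′ ∈ cutsF ts ] (Φʳ (proj₁ p ++ proj₁ p′) w * g (node a (proj₂ p) ∷ proj₂ p′))
               ≈⟨ ∑-cong (cutsF ts) (λ p′ → *-congʳ (Φʳ-++ (proj₁ p) (proj₁ p′) w)) ⟩
             ∑[ p′ ∈ cutsF ts ] ((Φʳ (proj₁ p) ⧢ Φʳ (proj₁ p′)) w * g (node a (proj₂ p) ∷ proj₂ p′))
               ≈⟨ ∑-⧢ʳ (cutsF ts) _ _ _ w ⟩
             (Φʳ (proj₁ p) ⧢ (λ v → ∑[ p′ ∈ cutsF ts ] (Φʳ (proj₁ p′) v * g (node a (proj₂ p) ∷ proj₂ p′)))) w
               ≈⟨ ⧢-cong (λ _ → refl) (cutsᵗ (λ r → g (node a (proj₂ p) ∷ r))) w ⟩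
             (Φʳ (proj₁ p) ⧢ rest (proj₂ p)) w ∎) ⟩
      ∑[ p ∈ cutsF us ] (Φʳ (proj₁ p) ⧢ rest (proj₂ p)) w
        ≈⟨ ∑-comm (cutsF us) (deshuffles K w) _ ⟩
      ∑⧢ w (λ u v → ∑[ p ∈ cutsF us ] (Φʳ (proj₁ p) u * rest (proj₂ p) v))
        ≈⟨ ∑-cong (deshuffles K w) (λ d → cutsᵘ (λ r → rest r (proj₂ d)) (proj₁ d)) ⟩
      ∑⧢ w (λ u v → ∑[ e ∈ allEdgeSubF us ] (rootFirstF (split us e) u * rest (joined us e) v))
        ≈⟨ ∑-comm (allEdgeSubF us) (deshuffles K w) _ ⟨
      ∑[ e ∈ allEdgeSubF us ] (rootFirstF (split us e) ⧢ rest (joined us e)) w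
        ≈⟨ ∑-cong (allEdgeSubF us) (λ e → begin
             (rootFirstF (split us e) ⧢ rest (joined us e)) w
               ≈⟨ ∑-⧢ʳ (allEdgeSubF ts) _ _ _ w ⟨
             ∑[ es ∈ allEdgeSubF ts ] ((rootFirstF (split us e) ⧢ rootFirstF (split ts es)) w * g (node a (joined us e) ∷ joined ts es))
               ≈⟨ ∑-cong (allEdgeSubF ts) (λ es → *-congʳ (sym (rootFirstF-++ (split us e) (split ts es) w))) ⟩
             ∑[ es ∈ allEdgeSubF ts ] (rootFirstF (split us e ++ split ts es) w * g (node a (joined us e) ∷ joined ts es)) ∎) ⟩
      ∑[ e ∈ allEdgeSubF us ] ∑[ es ∈ allEdgeSubF ts ]
        (rootFirstF (split us e ++ split ts es) w * g (node a (joined us e) ∷ joined ts es)) ∎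
      where
      rest : Forest 𝒟 → Sh
      rest r v = ∑[ es ∈ allEdgeSubF ts ] (rootFirstF (split ts es) v * g (node a r ∷ joined ts es))

  ∑-cutsF-∷ : ∀ (t : Tree 𝒟) ts (F : Forest 𝒟 × Forest 𝒟 → Carrier) →
    ∑ (cutsF (t ∷ ts)) F ≈ ∑[ p ∈ cutsT t ] ∑[ p′ ∈ cutsF ts ] F (proj₁ p ++ proj₁ p′ , proj₂ p ++ proj₂ p′)
  ∑-cutsF-∷ t ts F = trans (∑-concatMap (cutsT t) _ F) (∑-cong (cutsT t) (λ p → ∑-map (cutsF ts) _ F))

  ∑-allEdgeSubF-∷ : ∀ (t : Tree 𝒟) ts (F : EdgeSubF (t ∷ ts) → Carrier) →
    ∑ (allEdgeSubF (t ∷ ts)) F ≈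
    (∑[ e ∈ allEdgeSubT t ] ∑[ es ∈ allEdgeSubF ts ] F (true , e , es)) +
    (∑[ e ∈ allEdgeSubT t ] ∑[ es ∈ allEdgeSubF ts ] F (false , e , es))
  ∑-allEdgeSubF-∷ t ts F = trans (∑-concatMap (true ∷ false ∷ []) withEdge F) (trans (+-congˡ (+-identityʳ _))
    (+-cong (byEdge true) (byEdge false)))
    where
    withEdge : Bool → List (EdgeSubF (t ∷ ts))
    withEdge b = concatMap (λ e → map (λ es → (b , e , es)) (allEdgeSubF ts)) (allEdgeSubT t)
    byEdge : ∀ b → ∑ (withEdge b) F ≈
                   ∑[ e ∈ allEdgeSubT t ] ∑[ es ∈ allEdgeSubF ts ] F (b , e , es)
    byEdge b = trans (∑-concatMap (allEdgeSubT t) _ F) (∑-cong (allEdgeSubT t) (λ e → ∑-map (allEdgeSubF ts) _ F))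

  cutExpansion-∷ : ∀ a us ts → TreeExpansion (node a us) → CutExpansion us → CutExpansion ts →
                   CutExpansion (node a us ∷ ts)
  cutExpansion-∷ a us ts tree cutsᵘ cutsᵗ g w = begin
    ∑[ p ∈ cutsF (t ∷ ts) ] (Φʳ (proj₁ p) w * g (proj₂ p))
      ≈⟨ ∑-cutsF-∷ t ts (λ p → Φʳ (proj₁ p) w * g (proj₂ p)) ⟩
    ∑[ p ∈ cutsT t ] ∑[ p′ ∈ cutsF ts ] (Φʳ (proj₁ p ++ proj₁ p′) w * g (proj₂ p ++ proj₂ p′))
      ≈⟨ +-congˡ (∑-map (cutsF us) (λ p → (proj₁ p , node a (proj₂ p) ∷ []))
                   (λ p → ∑[ p′ ∈ cutsF ts ] (Φʳ (proj₁ p ++ proj₁ p′) w * g (proj₂ p ++ proj₂ p′)))) ⟩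
    (∑[ p′ ∈ cutsF ts ] (Φʳ (t ∷ proj₁ p′) w * g (proj₂ p′))) +
    (∑[ p ∈ cutsF us ] ∑[ p′ ∈ cutsF ts ] (Φʳ (proj₁ p ++ proj₁ p′) w * g (node a (proj₂ p) ∷ proj₂ p′)))
      ≈⟨ +-cong (cutWholeTree a us ts g w tree cutsᵗ) (cutBelowRoot a us ts g w cutsᵘ cutsᵗ) ⟩
    edgeNotInE + edgeInE
      ≈⟨ +-comm _ _ ⟩
    edgeInE + edgeNotInE
      ≈⟨ ∑-allEdgeSubF-∷ t ts (λ e → rootFirstF (split (t ∷ ts) e) w * g (joined (t ∷ ts) e)) ⟨
    ∑[ e ∈ allEdgeSubF (t ∷ ts) ] (rootFirstF (split (t ∷ ts) e) w * g (joined (t ∷ ts) e)) ∎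
    where
    t : Tree 𝒟
    t = node a us
    edgeInE edgeNotInE : Carrier
    edgeInE = ∑[ e ∈ allEdgeSubF us ] ∑[ es ∈ allEdgeSubF ts ]
                (rootFirstF (split us e ++ split ts es) w * g (node a (joined us e) ∷ joined ts es))
    edgeNotInE = ∑[ e ∈ allEdgeSubF us ] ∑[ es ∈ allEdgeSubF ts ] (rootFirstF (contT t e ∷ split ts es) w * g (joined ts es))

  treeExpansion : ∀ T → TreeExpansion T
  cutExpansion : ∀ ts → CutExpansion ts
  treeExpansion (node x ts) = treeExpansion-node x ts (cutExpansion ts)
  cutExpansion []               = cutExpansion-[]
  cutExpansion (node a us ∷ ts) = cutExpansion-∷ a us ts (treeExpansion (node a us)) (cutExpansion us) (cutExpansion ts)

mainTheorem13 : ∀ {c ℓ d} (K : CommutativeRing c ℓ) → IsFieldCR K → CharZero K →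
    (𝒟 : Set d) → 𝒟 →
    (φ : Tree 𝒟 → 𝒟 → CommutativeRing.Carrier K) → IsTreeMap K φ →
    (Φ : Forest 𝒟 → List 𝒟 → CommutativeRing.Carrier K) → IsHopfMorphismWith K φ Φ →
    ∀ (T : Tree 𝒟) (w : List 𝒟) →
    CommutativeRing._≈_ K (Φ (T ∷ []) w) (formulaRHS K φ T w)
mainTheorem13 K _ _ 𝒟 _ φ _ Φ Φ-hopf T w = begin
  Φ (T ∷ []) w
    ≡⟨ ≡.cong (Φ (T ∷ [])) (List.reverse-involutive w) ⟨
  Φʳ (T ∷ []) (reverse w)
    ≈⟨ treeExpansion T (reverse w) ⟩
  ∑[ e ∈ allEdgeSubT T ] rootFirstT (contT T e) (reverse w)
    ≈⟨ ∑-cong (allEdgeSubT T) (λ e → linExtSum≈rootFirstT (contT T e) w) ⟨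
  ∑[ e ∈ allEdgeSubT T ] linExtSum (contT T e) w
    ≈⟨ ∑-cong (allEdgeSubT T) (λ e → ∑-map (linExt (contT T e)) _ id) ⟨
  ∑[ e ∈ allEdgeSubT T ] ∑ (terms e) id
    ≈⟨ ∑-concatMap (allEdgeSubT T) terms id ⟨
  ∑ (concatMap terms (allEdgeSubT T)) id
    ≡⟨ ≡.cong (sumK K) (List.map-id (concatMap terms (allEdgeSubT T))) ⟩
  formulaRHS K φ T w ∎
  where
  open CommutativeRing K
  open RingSums K
  open RootFirst K φ
  open Expansion K φ Φ Φ-hopf
  open import Relation.Binary.Reasoning.Setoid setoid
  terms : EdgeSubT T → List Carrier
  terms e = map (λ τ → concatProd K (reverse (toList (Vec.map (λ v → φ (vdec (contT T e) v)) τ))) w)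
                (linExt (contT T e))
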